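{- Let $H$ be a connected hypergraph and let $f\in\mathcal V_p(H)$, $p\ge1$. If $H$ is $f$-hard, then: (a) $f_1(v)+f_2(v)+\cdots+f_p(v)=d_H(v)$ for all $v\in V(H)$; (b) if $u\ne u'$ are two non-separating vertices of $H$ contained in the same block of $H$, then either $f(u)=f(u')$ or $f_i(u)=f_i(u')=0$ for all but one index $i\in\{1,\dots,p\}$; (c) $H$ is not $f$-partitionable.
   Context: A hypergraph $H=(V,E,i)$ consists of finite sets $V(H)$, $E(H)$ and an incidence function $i_H:E\to 2^V$ with $|i(e)|\ge 2$ (parallel edges allowed; edges with $|i(e)|=2$ are ordinary). $H[X]$ is the subhypergraph with vertex set $X$ and edges $e$ with $i_H(e)\subseteq X$; such subhypergraphs are induced. The degree $d_H(v)$ is the number of edges incident with $v$. $H$ is connected if nonempty and for every $\emptyset\ne X\subsetneq V(H)$ some edge meets both $X$ and its complement. A vertex $v$ is separating if $H$ is the union of two induced subhypergraphs $H_1,H_2$ with $V(H_1)\cap V(H_2)=\{v\}$, $|V(H_i)|\ge2$; a block is a maximal connected subhypergraph without separating vertex. For $h:V(H)\to\mathbb N_0$, $H$ is strictly $h$-degenerate if every nonempty subhypergraph $G$ has a vertex $v$ with $d_G(v)<h(v)$. $\mathcal V_p(H)$ is the set of $f=(f_1,\dots,f_p):V(H)\to\mathbb N_0^p$. An $f$-partition is a sequence $(H_1,\dots,H_p)$ of pairwise vertex-disjoint, possibly empty, induced subhypergraphs covering $V(H)$ with each $H_i$ strictly $f_i$-degenerate; $H$ is $f$-partitionable if one exists.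 $tK_n$: $n$ vertices, each pair joined by exactly $t$ parallel ordinary edges, no other edges; $tC_n$ ($n\ge3$): cycle of length $n$ with each edge replaced by $t$ parallel ordinary edges. Merging disjoint $H^1,H^2$ at $v^1\in V(H^1),v^2\in V(H^2)$: identify $v^1,v^2$ to a new vertex $v^*$, keeping all edges. $(H,f)$ with $H$ connected is a hard pair ($H$ is $f$-hard) if: (M) $H$ is a block and for some $j$, $f_j(v)=d_H(v)$ and $f_i(v)=0$ for $i\ne j$, all $v$; or (K) $H=tK_n$, $t\ge1,n\ge3$, and $f(v)=(tn_1,\dots,tn_p)$ for all $v$, with integers $n_i\ge0$, at least two nonzero, $\sum n_i=n-1$; or (C) $H=tC_n$, $t\ge1$, $n\ge5$ odd, and for some $k\ne\ell$, $f_k\equiv f_\ell\equiv t$ and all other coordinates $\equiv 0$; or (merge) $(H,f)$ arises from hard pairs $(H^1,f^1),(H^2,f^2)$ by merging $v^1,v^2$ to $v^*$ with $f=f^j$ on $V(H^j)\setminus\{v^j\}$ and $f(v^*)=f^1(v^1)+f^2(v^2)$. -}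

module Defs where

open import Data.Nat using (ℕ; zero; suc; _+_; _*_; _≤_; _<_)
open import Data.Fin using (Fin; toℕ)
open import Data.Fin.Subset using (Subset; _∈_; _∉_; _⊆_; _∪_; _∩_; ⁅_⁆; ∣_∣; Nonempty)
open import Data.Fin.Subset.Properties using (_∈?_)
open import Data.Vec using (Vec; tabulate; lookup; sum; map; zipWith)
open import Data.Vec.Properties using (≡-dec)
open import Data.Bool using (Bool)
open import Data.Bool.Properties using () renaming (_≟_ to _≟𝔹_)
open import Data.Product using (Σ; ∃; ∃-syntax; _×_; _,_)
open import Data.Sum using (_⊎_)
open import Relation.Nullary using (¬_; does)
open import Relation.Binary.PropositionalEquality using (_≡_; _≢_)
open import Function.Bundles using (_↔_; Inverse)

-- Hypergraphs: V(H) = Fin nV, E(H) = Fin nE, incidence inc : E → 2^V,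
-- every edge has at least two vertices (parallel edges allowed).

record Hypergraph : Set where
  field
    nV    : ℕ
    nE    : ℕ
    inc   : Fin nE → Subset nV
    inc≥2 : ∀ e → 2 ≤ ∣ inc e ∣
open Hypergraph public

Vtx : Hypergraph → Set
Vtx H = Fin (nV H)

Edg : Hypergraph → Set
Edg H = Fin (nE H)

VSet : Hypergraph → Set
VSet H = Subset (nV H)

ESet : Hypergraph → Set
ESet H = Subset (nE H)

allV : (H : Hypergraph) → VSet H
allV H = Data.Fin.Subset.⊤

allE : (H : Hypergraph) → ESet H
allE H = Data.Fin.Subset.⊤

∁ : ∀ {n} → Subset n → Subset n
∁ = Data.Fin.Subset.∁

-- Subhypergraphs of H: a vertex set Y and an edge set F with
-- i_H(e) ⊆ Y for every e ∈ F (incidence inherited from H).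

IsSub : (H : Hypergraph) → VSet H → ESet H → Set
IsSub H Y F = ∀ e → e ∈ F → inc H e ⊆ Y

degIn : (H : Hypergraph) → ESet H → Vtx H → ℕ
degIn H F v = ∣ F ∩ tabulate (λ e → does (v ∈? inc H e)) ∣

deg : (H : Hypergraph) → Vtx H → ℕ
deg H = degIn H (allE H)

Meets : (H : Hypergraph) → Edg H → VSet H → Set
Meets H e X = ∃[ x ] (x ∈ inc H e × x ∈ X)

ConnectedSub : (H : Hypergraph) → VSet H → ESet H → Set
ConnectedSub H Y F =
  Nonempty Y ×
  (∀ (X : VSet H) → X ⊆ Y → Nonempty X → Nonempty (Y ∩ ∁ X) →
     ∃[ e ] (e ∈ F × Meets H e X × Meets H e (Y ∩ ∁ X)))

-- v is a separating vertex of the subhypergraph (Y,F): (Y,F) is the union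
-- of two induced subhypergraphs (of (Y,F)) on X₁, X₂ with X₁ ∩ X₂ = {v},
-- |X₁|,|X₂| ≥ 2.  "Union" means X₁ ∪ X₂ = Y and every edge of F lies
-- inside X₁ or inside X₂.
SeparatingSub : (H : Hypergraph) → VSet H → ESet H → Vtx H → Set
SeparatingSub H Y F v =
  ∃[ X₁ ] ∃[ X₂ ]
    (X₁ ∪ X₂ ≡ Y × X₁ ∩ X₂ ≡ ⁅ v ⁆ × 2 ≤ ∣ X₁ ∣ × 2 ≤ ∣ X₂ ∣ ×
     (∀ e → e ∈ F → inc H e ⊆ X₁ ⊎ inc H e ⊆ X₂))

NonSepConnected : (H : Hypergraph) → VSet H → ESet H → Set
NonSepConnected H Y F =
  IsSub H Y F × ConnectedSub H Y F × (∀ v → ¬ SeparatingSub H Y F v)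

IsBlock : (H : Hypergraph) → VSet H → ESet H → Set
IsBlock H Y F =
  NonSepConnected H Y F ×
  (∀ Y' F' → NonSepConnected H Y' F' → Y ⊆ Y' → F ⊆ F' → Y' ≡ Y × F' ≡ F)

Connected : Hypergraph → Set
Connected H = ConnectedSub H (allV H) (allE H)

Separating : (H : Hypergraph) → Vtx H → Set
Separating H = SeparatingSub H (allV H) (allE H)

SameBlock : (H : Hypergraph) → Vtx H → Vtx H → Set
SameBlock H u u' = ∃[ Y ] ∃[ F ] (IsBlock H Y F × u ∈ Y × u' ∈ Y)

-- Strict degeneracy and f-partitions.
-- f ∈ V_p(H) is represented as f : Vtx H → Vec ℕ p, f_i(v) = lookup (f v) i.

StrictlyDegenerate : (H : Hypergraph) → VSet H → (Vtx H → ℕ) → Set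
StrictlyDegenerate H X h =
  ∀ (Y : VSet H) (F : ESet H) → IsSub H Y F → Y ⊆ X → Nonempty Y →
    ∃[ v ] (v ∈ Y × degIn H F v < h v)

IsPartition : ∀ {p} (H : Hypergraph) → (Vtx H → Vec ℕ p) → (Fin p → VSet H) → Set
IsPartition {p} H f X =
  (∀ i j → i ≢ j → ∀ v → v ∈ X i → v ∉ X j) ×
  (∀ v → ∃[ i ] (v ∈ X i)) ×
  (∀ i → StrictlyDegenerate H (X i) (λ v → lookup (f v) i))

Partitionable : ∀ {p} (H : Hypergraph) → (Vtx H → Vec ℕ p) → Set
Partitionable {p} H f = ∃[ X ] IsPartition {p} H f X

mult : (H : Hypergraph) → Vtx H → Vtx H → ℕ
mult H x y = ∣ tabulate (λ e → does (≡-dec _≟𝔹_ (inc H e) (⁅ x ⁆ ∪ ⁅ y ⁆))) ∣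

AllOrdinary : Hypergraph → Set
AllOrdinary H = ∀ e → ∣ inc H e ∣ ≡ 2

IsTK : ℕ → ℕ → Hypergraph → Set
IsTK t n H = nV H ≡ n × AllOrdinary H × (∀ x y → x ≢ y → mult H x y ≡ t)

CycSucc : (N : ℕ) → Fin N → Fin N → Set
CycSucc N i j = suc (toℕ i) ≡ toℕ j ⊎ (suc (toℕ i) ≡ N × toℕ j ≡ 0)

CycAdj : (N : ℕ) → Fin N → Fin N → Set
CycAdj N i j = CycSucc N i j ⊎ CycSucc N j i

-- H is (isomorphic to) tC_n: the n vertices can be listed in cyclic order
-- σ(0),…,σ(n-1) (σ injective) such that cyclically consecutive vertices are
-- joined by exactly t parallel ordinary edges and no other edges exist.
IsTC : ℕ → ℕ → Hypergraph → Set
IsTC t n H = nV H ≡ n × AllOrdinary H ×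
  Σ (Fin (nV H) → Vtx H) λ σ → ((∀ i j → σ i ≡ σ j → i ≡ j) ×
          (∀ i j → i ≢ j → (CycAdj (nV H) i j → mult H (σ i) (σ j) ≡ t)
                          × (¬ CycAdj (nV H) i j → mult H (σ i) (σ j) ≡ 0)))

Odd : ℕ → Set
Odd n = ∃[ k ] (n ≡ suc (2 * k))

-- H arises (up to isomorphism) by merging disjoint H¹, H² at v¹, v²:
-- embeddings φ₁, φ₂ of the vertex sets into V(H), jointly surjective,
-- overlapping exactly in φ₁ v¹ = φ₂ v² (= v*), and a bijection
-- E(H¹) ⊎ E(H²) ↔ E(H) transporting the incidences.
record MergeData (H¹ H² H : Hypergraph) (v¹ : Vtx H¹) (v² : Vtx H²) : Set where
  field
    φ₁ : Vtx H¹ → Vtx H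
    φ₂ : Vtx H² → Vtx H
    φ₁-inj : ∀ a b → φ₁ a ≡ φ₁ b → a ≡ b
    φ₂-inj : ∀ a b → φ₂ a ≡ φ₂ b → a ≡ b
    glue   : φ₁ v¹ ≡ φ₂ v²
    meet-at : ∀ a b → φ₁ a ≡ φ₂ b → a ≡ v¹
    cover  : ∀ x → (∃[ a ] φ₁ a ≡ x) ⊎ (∃[ b ] φ₂ b ≡ x)
    ψ      : (Edg H¹ ⊎ Edg H²) ↔ Edg H
    inc₁   : ∀ e a → (a ∈ inc H¹ e → φ₁ a ∈ inc H (Inverse.to ψ (Data.Sum.inj₁ e)))
                   × (φ₁ a ∈ inc H (Inverse.to ψ (Data.Sum.inj₁ e)) → a ∈ inc H¹ e)
    inc₁⊆  : ∀ e x → x ∈ inc H (Inverse.to ψ (Data.Sum.inj₁ e)) → ∃[ a ] φ₁ a ≡ x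
    inc₂   : ∀ e b → (b ∈ inc H² e → φ₂ b ∈ inc H (Inverse.to ψ (Data.Sum.inj₂ e)))
                   × (φ₂ b ∈ inc H (Inverse.to ψ (Data.Sum.inj₂ e)) → b ∈ inc H² e)
    inc₂⊆  : ∀ e x → x ∈ inc H (Inverse.to ψ (Data.Sum.inj₂ e)) → ∃[ b ] φ₂ b ≡ x

data Hard {p : ℕ} : (H : Hypergraph) → (Vtx H → Vec ℕ p) → Set where
  hard-M : ∀ H f → IsBlock H (allV H) (allE H) →
           (j : Fin p) →
           (∀ v i → (i ≡ j → lookup (f v) i ≡ deg H v) × (i ≢ j → lookup (f v) i ≡ 0)) →
           Hard H f
  hard-K : ∀ H f (t n : ℕ) → 1 ≤ t → 3 ≤ n → IsTK t n H →
           (ns : Vec ℕ p) → sum ns + 1 ≡ n →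
           (∃[ i ] ∃[ j ] (i ≢ j × lookup ns i ≢ 0 × lookup ns j ≢ 0)) →
           (∀ v → f v ≡ map (t *_) ns) →
           Hard H f
  hard-C : ∀ H f (t n : ℕ) → 1 ≤ t → 5 ≤ n → Odd n → IsTC t n H →
           (k ℓ : Fin p) → k ≢ ℓ →
           (∀ v i → ((i ≡ k ⊎ i ≡ ℓ) → lookup (f v) i ≡ t)
                  × (i ≢ k → i ≢ ℓ → lookup (f v) i ≡ 0)) →
           Hard H f
  hard-merge : ∀ H¹ f¹ H² f² H f (v¹ : Vtx H¹) (v² : Vtx H²) →
           Hard H¹ f¹ → Hard H² f² →
           (m : MergeData H¹ H² H v¹ v²) →
           (∀ a → a ≢ v¹ → f (MergeData.φ₁ m a) ≡ f¹ a) →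
           (∀ b → b ≢ v² → f (MergeData.φ₂ m b) ≡ f² b) →
           f (MergeData.φ₁ m v¹) ≡ zipWith _+_ (f¹ v¹) (f² v²) →
           Hard H f

HardPair : ∀ {p} (H : Hypergraph) → (Vtx H → Vec ℕ p) → Set
HardPair {p} H f = Connected H × Hard {p} H f

module Submission where

-- (a) The degree of a vertex of an ordinary hypergraph is the sum of its edge
--     multiplicities, which gives d = t(n-1) in tK_n and d = 2t in tC_n; in a
--     merge, degrees add up at the merged vertex and are unchanged elsewhere.
-- (c) We prove the stronger statement that every cover of V(H) by pairwise
--     disjoint classes X_i admits an *obstruction*: a nonempty subhypergraph
--     inside some X_i in which every vertex has degree ≥ f_i.  For (M) it is H
--     itself or a single vertex with f_i = 0, for (K) a class with more than
--     n_i vertices (pigeonhole), for (C) a vertex with f_i = 0 or two adjacent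
--     vertices in one class (an odd cycle is not 2-colourable), and for a
--     merge the obstructions of the two halves glue at the merged vertex.
-- (b) is proved for every connected subhypergraph without separating vertex.
--     Such a subhypergraph of a merge lies inside one half, is again of this
--     kind there, and separating vertices of a half stay separating in H; the
--     merged vertex is non-separating only if one half is a single vertex, in
--     which case that half contributes nothing to f.

open import Defs
open import Data.Nat using (ℕ; zero; suc; _+_; _*_; _≤_; _<_; z≤n; s≤s)
import Data.Nat.Properties as ℕP
open import Data.Bool using (Bool; true; false; _∧_; not)
import Data.Bool.Properties as BP
open import Data.Fin using (Fin; zero; suc; toℕ; _↑ˡ_; _↑ʳ_)
import Data.Fin.Properties as FP
open import Data.Fin.Subset using (Subset; _∈_; _∉_; _⊆_; _∪_; _∩_; _-_; ⁅_⁆; ∣_∣; Nonempty) renaming (⊥ to ∅)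
open import Data.Fin.Subset.Properties
  using (_∈?_; _⊆?_; x∈⁅x⁆; x∈⁅y⁆⇒x≡y; ∣⁅x⁆∣≡1; p⊆q⇒∣p∣≤∣q∣; drop-∷-⊆; x∈p∪q⁻; x∈p∪q⁺;
         x∈p∩q⁺; x∈p∩q⁻; ⊆-antisym; ∈⊤; ∉⊥; nonempty?; x∈∁p⇒x∉p; x∉p⇒x∈∁p;
         x∈p⇒∣p-x∣<∣p∣; x∈p∧x≢y⇒x∈p-y; ∪-comm; ∩-comm)
open import Data.Vec using (Vec; []; _∷_; tabulate; lookup; sum; map; zipWith)
import Data.Vec.Properties as VP
open import Data.Product using (∃-syntax; _×_; _,_; proj₁; proj₂)
open import Data.Sum using (_⊎_; inj₁; inj₂; [_,_]′)
open import Data.Empty using (⊥; ⊥-elim)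
open import Relation.Nullary using (¬_; Dec; yes; no; does; ¬?)
open import Relation.Nullary.Decidable using (_×-dec_; decidable-stable; dec-true; dec-false)
open import Relation.Binary.PropositionalEquality
  using (_≡_; _≢_; refl; sym; trans; cong; cong₂; subst; subst₂; module ≡-Reasoning)
open import Function.Bundles using (Inverse)
open import Function.Construct.Composition using (_↔-∘_)
open import Algebra.Properties.CommutativeMonoid.Sum ℕP.+-0-commutativeMonoid
  using (∑-comm; sum-cong-≗; ∑-distrib-+; ∑-permute) renaming (sum to ∑)

-- Subsets are bit vectors; `χ` turns a bit into 0 or 1, so that cardinalities
-- and degrees become finite sums ∑ of indicators.

χ : Bool → ℕ
χ true = 1
χ false = 0

χ-∧ : ∀ a b → χ (a ∧ b) ≡ χ a * χ b
χ-∧ true  b = sym (ℕP.+-identityʳ (χ b))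
χ-∧ false b = refl

lookup-∈ : ∀ {n} {x : Fin n} {p : Subset n} → x ∈ p → lookup p x ≡ true
lookup-∈ = VP.[]=⇒lookup

∈-lookup : ∀ {n} {x : Fin n} {p : Subset n} → lookup p x ≡ true → x ∈ p
∈-lookup {x = x} {p} = VP.lookup⇒[]= x p

lookup-∉ : ∀ {n} {x : Fin n} {p : Subset n} → x ∉ p → lookup p x ≡ false
lookup-∉ {x = x} {p} x∉p with lookup p x in eq
... | true  = ⊥-elim (x∉p (∈-lookup eq))
... | false = refl

∈-tabulate : ∀ {n} {P : Fin n → Set} (P? : ∀ x → Dec (P x)) x → x ∈ tabulate (λ y → does (P? y)) → P x
∈-tabulate P? x x∈ with P? x | trans (sym (VP.lookup∘tabulate _ x)) (lookup-∈ x∈)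
... | yes px | _ = px

tabulate-∈ : ∀ {n} {P : Fin n → Set} (P? : ∀ x → Dec (P x)) x → P x → x ∈ tabulate (λ y → does (P? y))
tabulate-∈ P? x px = ∈-lookup (trans (VP.lookup∘tabulate _ x) (dec-true (P? x) px))

does-⇔ : ∀ {A B : Set} (A? : Dec A) (B? : Dec B) → (A → B) → (B → A) → does A? ≡ does B?
does-⇔ (yes a) B? f g = sym (dec-true B? (f a))
does-⇔ (no ¬a) B? f g = sym (dec-false B? (λ b → ¬a (g b)))

∑-cong : ∀ {n} {f g : Fin n → ℕ} → (∀ i → f i ≡ g i) → ∑ f ≡ ∑ g
∑-cong = sum-cong-≗

∑-mono : ∀ {n} {f g : Fin n → ℕ} → (∀ i → f i ≤ g i) → ∑ f ≤ ∑ g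
∑-mono {zero}  h = z≤n
∑-mono {suc n} h = ℕP.+-mono-≤ (h zero) (∑-mono (λ i → h (suc i)))

∑-zero : ∀ {n} {f : Fin n → ℕ} → (∀ i → f i ≡ 0) → ∑ f ≡ 0
∑-zero {zero}  h = refl
∑-zero {suc n} h = cong₂ _+_ (h zero) (∑-zero (λ i → h (suc i)))

∑-single : ∀ {n} {f : Fin n → ℕ} (j : Fin n) → (∀ i → i ≢ j → f i ≡ 0) → ∑ f ≡ f j
∑-single {suc n} {f} zero h =
  trans (cong (f zero +_) (∑-zero (λ i → h (suc i) (λ ())))) (ℕP.+-identityʳ _)
∑-single {suc n} {f} (suc j) h =
  trans (cong (_+ ∑ (λ i → f (suc i))) (h zero (λ ())))
        (∑-single j (λ i i≢j → h (suc i) (λ eq → i≢j (FP.suc-injective eq))))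

∑-indicator : ∀ {n} (a : Fin n) c → ∑ (λ i → χ (does (i FP.≟ a)) * c) ≡ c
∑-indicator a c =
  trans (∑-single a (λ i i≢a → cong (λ b → χ b * c) (dec-false (i FP.≟ a) i≢a)))
        (trans (cong (λ b → χ b * c) (dec-true (a FP.≟ a) refl)) (ℕP.+-identityʳ c))

∑-pair : ∀ {n} {f : Fin n → ℕ} (a b : Fin n) → a ≢ b → (∀ i → i ≢ a → i ≢ b → f i ≡ 0) →
         ∑ f ≡ f a + f b
∑-pair {f = f} a b a≢b h = begin
  ∑ f                                                     ≡⟨ ∑-cong split ⟩
  ∑ (λ i → χ (does (i FP.≟ a)) * f a + χ (does (i FP.≟ b)) * f b)
    ≡⟨ ∑-distrib-+ (λ i → χ (does (i FP.≟ a)) * f a) (λ i → χ (does (i FP.≟ b)) * f b) ⟩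
  ∑ (λ i → χ (does (i FP.≟ a)) * f a) + ∑ (λ i → χ (does (i FP.≟ b)) * f b)
    ≡⟨ cong₂ _+_ (∑-indicator a (f a)) (∑-indicator b (f b)) ⟩
  f a + f b                                               ∎
  where
  open ≡-Reasoning
  split : ∀ i → f i ≡ χ (does (i FP.≟ a)) * f a + χ (does (i FP.≟ b)) * f b
  split i with i FP.≟ a | i FP.≟ b
  ... | yes refl | yes refl = ⊥-elim (a≢b refl)
  ... | yes refl | no _     = sym (trans (ℕP.+-identityʳ _) (ℕP.+-identityʳ _))
  ... | no _     | yes refl = sym (ℕP.+-identityʳ _)
  ... | no i≢a   | no i≢b   = h i i≢a i≢b

∑-const : ∀ n c → ∑ {n} (λ _ → c) ≡ n * c
∑-const zero    c = refl
∑-const (suc n) c = cong (c +_) (∑-const n c)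

∑-*ʳ : ∀ {n} (f : Fin n → ℕ) c → ∑ (λ i → f i * c) ≡ ∑ f * c
∑-*ʳ {zero}  f c = refl
∑-*ʳ {suc n} f c =
  trans (cong (f zero * c +_) (∑-*ʳ (λ i → f (suc i)) c)) (sym (ℕP.*-distribʳ-+ c (f zero) _))

∑-splitAt : ∀ m n (h : Fin (m + n) → ℕ) → ∑ h ≡ ∑ (λ i → h (i ↑ˡ n)) + ∑ (λ j → h (m ↑ʳ j))
∑-splitAt zero    n h = refl
∑-splitAt (suc m) n h =
  trans (cong (h zero +_) (∑-splitAt m n (λ i → h (suc i)))) (sym (ℕP.+-assoc (h zero) _ _))

sum-as-∑ : ∀ {n} (xs : Vec ℕ n) → sum xs ≡ ∑ (lookup xs)
sum-as-∑ []       = refl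
sum-as-∑ (x ∷ xs) = cong (x +_) (sum-as-∑ xs)

sum-zipWith-+ : ∀ {n} (xs ys : Vec ℕ n) → sum (zipWith _+_ xs ys) ≡ sum xs + sum ys
sum-zipWith-+ xs ys = begin
  sum (zipWith _+_ xs ys)                       ≡⟨ sum-as-∑ (zipWith _+_ xs ys) ⟩
  ∑ (lookup (zipWith _+_ xs ys))                ≡⟨ ∑-cong (λ i → VP.lookup-zipWith _+_ i xs ys) ⟩
  ∑ (λ i → lookup xs i + lookup ys i)           ≡⟨ ∑-distrib-+ (lookup xs) (lookup ys) ⟩
  ∑ (lookup xs) + ∑ (lookup ys)                 ≡⟨ sym (cong₂ _+_ (sum-as-∑ xs) (sum-as-∑ ys)) ⟩
  sum xs + sum ys                               ∎
  where open ≡-Reasoning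

sum-map-* : ∀ {n} t (xs : Vec ℕ n) → sum (map (t *_) xs) ≡ t * sum xs
sum-map-* t []       = sym (ℕP.*-zeroʳ t)
sum-map-* t (x ∷ xs) = trans (cong (t * x +_) (sum-map-* t xs)) (sym (ℕP.*-distribˡ-+ t x (sum xs)))

sum≡0⇒lookup≡0 : ∀ {p} (xs : Vec ℕ p) → sum xs ≡ 0 → ∀ i → lookup xs i ≡ 0
sum≡0⇒lookup≡0 (x ∷ xs) eq zero    = ℕP.m+n≡0⇒m≡0 x eq
sum≡0⇒lookup≡0 (x ∷ xs) eq (suc i) = sum≡0⇒lookup≡0 xs (ℕP.m+n≡0⇒n≡0 x eq) i

zipWith-+-zero : ∀ {p} (xs ys : Vec ℕ p) → (∀ i → lookup ys i ≡ 0) → zipWith _+_ xs ys ≡ xs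
zipWith-+-zero []       []       h = refl
zipWith-+-zero (x ∷ xs) (y ∷ ys) h =
  cong₂ _∷_ (trans (cong (x +_) (h zero)) (ℕP.+-identityʳ x)) (zipWith-+-zero xs ys (λ i → h (suc i)))

zipWith-+-comm : ∀ {p} (xs ys : Vec ℕ p) → zipWith _+_ xs ys ≡ zipWith _+_ ys xs
zipWith-+-comm xs ys = VP.zipWith-comm ℕP.+-comm xs ys

lookup-ext : ∀ {p} {xs ys : Vec ℕ p} → (∀ i → lookup xs i ≡ lookup ys i) → xs ≡ ys
lookup-ext {xs = xs} {ys} h =
  trans (sym (VP.tabulate∘lookup xs)) (trans (VP.tabulate-cong h) (VP.tabulate∘lookup ys))

set-ext : ∀ {n} {p q : Subset n} → (∀ x → x ∈ p → x ∈ q) → (∀ x → x ∈ q → x ∈ p) → p ≡ q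
set-ext p⊆q q⊆p = ⊆-antisym (λ {x} → p⊆q x) (λ {x} → q⊆p x)

∈∩ : ∀ {n} {p q : Subset n} {x} → x ∈ p → x ∈ q → x ∈ p ∩ q
∈∩ x∈p x∈q = x∈p∩q⁺ (x∈p , x∈q)

∩⇒ˡ : ∀ {n} {p q : Subset n} {x} → x ∈ p ∩ q → x ∈ p
∩⇒ˡ {p = p} {q} x∈ = proj₁ (x∈p∩q⁻ p q x∈)

∩⇒ʳ : ∀ {n} {p q : Subset n} {x} → x ∈ p ∩ q → x ∈ q
∩⇒ʳ {p = p} {q} x∈ = proj₂ (x∈p∩q⁻ p q x∈)

∪⇒ : ∀ {n} {p q : Subset n} {x} → x ∈ p ∪ q → x ∈ p ⊎ x ∈ q
∪⇒ {p = p} {q} x∈ = x∈p∪q⁻ p q x∈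

∈∪ˡ : ∀ {n} {p q : Subset n} {x} → x ∈ p → x ∈ p ∪ q
∈∪ˡ x∈p = x∈p∪q⁺ (inj₁ x∈p)

∈∪ʳ : ∀ {n} {p q : Subset n} {x} → x ∈ q → x ∈ p ∪ q
∈∪ʳ x∈q = x∈p∪q⁺ (inj₂ x∈q)

∈⁅⁆⇒≡ : ∀ {n} {x y : Fin n} → x ∈ ⁅ y ⁆ → x ≡ y
∈⁅⁆⇒≡ {y = y} = x∈⁅y⁆⇒x≡y y

≡⇒∈⁅⁆ : ∀ {n} {x y : Fin n} → x ≡ y → x ∈ ⁅ y ⁆
≡⇒∈⁅⁆ {x = x} refl = x∈⁅x⁆ x

∈pair⇒ : ∀ {n} {v y x : Fin n} → x ∈ ⁅ v ⁆ ∪ ⁅ y ⁆ → x ≡ v ⊎ x ≡ y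
∈pair⇒ x∈ = Data.Sum.map ∈⁅⁆⇒≡ ∈⁅⁆⇒≡ (∪⇒ x∈)

∈pairˡ : ∀ {n} (v y : Fin n) → v ∈ ⁅ v ⁆ ∪ ⁅ y ⁆
∈pairˡ v y = ∈∪ˡ (x∈⁅x⁆ v)

∈pairʳ : ∀ {n} (v y : Fin n) → y ∈ ⁅ v ⁆ ∪ ⁅ y ⁆
∈pairʳ v y = ∈∪ʳ (x∈⁅x⁆ y)

pair⊆ : ∀ {n} {p : Subset n} {v y : Fin n} → v ∈ p → y ∈ p → ⁅ v ⁆ ∪ ⁅ y ⁆ ⊆ p
pair⊆ v∈p y∈p x∈ with ∈pair⇒ x∈
... | inj₁ refl = v∈p
... | inj₂ refl = y∈p

∣_∣-as-∑ : ∀ {n} (p : Subset n) → ∣ p ∣ ≡ ∑ (λ i → χ (lookup p i))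
∣ []         ∣-as-∑ = refl
∣ true  ∷ p ∣-as-∑ = cong suc ∣ p ∣-as-∑
∣ false ∷ p ∣-as-∑ = ∣ p ∣-as-∑

empty⇒∣∣≡0 : ∀ {n} (p : Subset n) → ¬ Nonempty p → ∣ p ∣ ≡ 0
empty⇒∣∣≡0 p ¬ne = trans ∣ p ∣-as-∑ (∑-zero (λ i → cong χ (lookup-∉ (λ i∈ → ¬ne (i , i∈)))))

⊆-∣∣≥⇒≡ : ∀ {n} {p q : Subset n} → p ⊆ q → ∣ q ∣ ≤ ∣ p ∣ → p ≡ q
⊆-∣∣≥⇒≡ {p = []}        {[]}        _   _ = refl
⊆-∣∣≥⇒≡ {p = true ∷ p}  {true ∷ q}  p⊆q (s≤s c) = cong (true ∷_) (⊆-∣∣≥⇒≡ (drop-∷-⊆ p⊆q) c)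
⊆-∣∣≥⇒≡ {p = true ∷ p}  {false ∷ q} p⊆q c with p⊆q Data.Vec.here
... | ()
⊆-∣∣≥⇒≡ {p = false ∷ p} {true ∷ q}  p⊆q c =
  ⊥-elim (ℕP.<-irrefl refl (ℕP.≤-trans c (p⊆q⇒∣p∣≤∣q∣ (drop-∷-⊆ p⊆q))))
⊆-∣∣≥⇒≡ {p = false ∷ p} {false ∷ q} p⊆q c = cong (false ∷_) (⊆-∣∣≥⇒≡ (drop-∷-⊆ p⊆q) c)

⊆single⇒∣∣≤1 : ∀ {n} (p : Subset n) (v : Fin n) → (∀ y → y ∈ p → y ≡ v) → ∣ p ∣ ≤ 1
⊆single⇒∣∣≤1 p v h = subst (∣ p ∣ ≤_) (∣⁅x⁆∣≡1 v) (p⊆q⇒∣p∣≤∣q∣ (λ {y} y∈ → ≡⇒∈⁅⁆ (h y y∈)))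

∣∣≥2⇒other : ∀ {n} (p : Subset n) (v : Fin n) → 2 ≤ ∣ p ∣ → ∃[ y ] (y ∈ p × y ≢ v)
∣∣≥2⇒other p v c with FP.any? (λ y → (y ∈? p) ×-dec (¬? (y FP.≟ v)))
... | yes found = found
... | no ¬found = ⊥-elim (ℕP.<-irrefl refl (ℕP.≤-trans c (⊆single⇒∣∣≤1 p v
      (λ y y∈ → decidable-stable (y FP.≟ v) (λ y≢v → ¬found (y , y∈ , y≢v))))))

∣∣≥2⇒two : ∀ {n} (p : Subset n) → 2 ≤ ∣ p ∣ → ∃[ a ] ∃[ b ] (a ∈ p × b ∈ p × a ≢ b)
∣∣≥2⇒two p c with nonempty? p
... | no ¬ne = ⊥-elim (ℕP.<-irrefl refl (ℕP.<-≤-trans (s≤s z≤n) (ℕP.≤-trans c (ℕP.≤-reflexive (empty⇒∣∣≡0 p ¬ne)))))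
... | yes (a , a∈) with ∣∣≥2⇒other p a c
... | b , b∈ , b≢a = a , b , a∈ , b∈ , (λ a≡b → b≢a (sym a≡b))

two⇒∣∣≥2 : ∀ {n} {p : Subset n} {a b} → a ∈ p → b ∈ p → a ≢ b → 2 ≤ ∣ p ∣
two⇒∣∣≥2 {p = p} {a} {b} a∈ b∈ a≢b = begin
  2                 ≡⟨ cong suc (sym (∣⁅x⁆∣≡1 b)) ⟩
  suc ∣ ⁅ b ⁆ ∣      ≤⟨ s≤s (p⊆q⇒∣p∣≤∣q∣ (λ {x} x∈ → subst (_∈ p - a) (sym (∈⁅⁆⇒≡ x∈)) b∈p-a)) ⟩
  suc ∣ p - a ∣      ≤⟨ x∈p⇒∣p-x∣<∣p∣ a∈ ⟩
  ∣ p ∣             ∎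
  where
  open ℕP.≤-Reasoning
  b∈p-a : b ∈ p - a
  b∈p-a = x∈p∧x≢y⇒x∈p-y b∈ (λ b≡a → a≢b (sym b≡a))

image : ∀ {m n} (φ : Fin m → Fin n) → Subset m → Subset n
image φ Y = tabulate (λ x → does (FP.any? (λ a → (a ∈? Y) ×-dec (φ a FP.≟ x))))

∈image : ∀ {m n} (φ : Fin m → Fin n) {Y : Subset m} a → a ∈ Y → φ a ∈ image φ Y
∈image φ {Y} a a∈ = tabulate-∈ (λ x → FP.any? (λ a → (a ∈? Y) ×-dec (φ a FP.≟ x))) (φ a) (a , a∈ , refl)

image⇒ : ∀ {m n} (φ : Fin m → Fin n) {Y : Subset m} x → x ∈ image φ Y → ∃[ a ] (a ∈ Y × φ a ≡ x)
image⇒ φ {Y} x = ∈-tabulate (λ x → FP.any? (λ a → (a ∈? Y) ×-dec (φ a FP.≟ x))) x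

image-injective : ∀ {m n} (φ : Fin m → Fin n) → (∀ a b → φ a ≡ φ b → a ≡ b) →
                  ∀ {Y} a → φ a ∈ image φ Y → a ∈ Y
image-injective φ inj {Y} a φa∈ with image⇒ φ (φ a) φa∈
... | c , c∈ , φc≡φa = subst (_∈ Y) (inj c a φc≡φa) c∈

image-∣∣≥2 : ∀ {m n} (φ : Fin m → Fin n) → (∀ a b → φ a ≡ φ b → a ≡ b) →
             ∀ Y → 2 ≤ ∣ Y ∣ → 2 ≤ ∣ image φ Y ∣
image-∣∣≥2 φ inj Y c with ∣∣≥2⇒two Y c
... | a , b , a∈ , b∈ , a≢b = two⇒∣∣≥2 (∈image φ a a∈) (∈image φ b b∈) (λ q → a≢b (inj a b q))

preimage : ∀ {m n} (φ : Fin m → Fin n) → Subset n → Subset m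
preimage φ X = tabulate (λ a → does (φ a ∈? X))

∈preimage : ∀ {m n} (φ : Fin m → Fin n) {X} a → φ a ∈ X → a ∈ preimage φ X
∈preimage φ {X} = tabulate-∈ (λ a → φ a ∈? X)

preimage⇒ : ∀ {m n} (φ : Fin m → Fin n) {X} a → a ∈ preimage φ X → φ a ∈ X
preimage⇒ φ {X} = ∈-tabulate (λ a → φ a ∈? X)

degIn-as-∑ : ∀ H (F : ESet H) v → degIn H F v ≡ ∑ (λ e → χ (lookup F e ∧ does (v ∈? inc H e)))
degIn-as-∑ H F v =
  trans ∣ F ∩ incident ∣-as-∑
        (∑-cong (λ e → cong χ (trans (VP.lookup-zipWith _∧_ e F incident)
                                     (cong (lookup F e ∧_) (VP.lookup∘tabulate _ e)))))
  where
  incident : ESet H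
  incident = tabulate (λ e → does (v ∈? inc H e))

deg-as-∑ : ∀ H v → deg H v ≡ ∑ (λ e → χ (does (v ∈? inc H e)))
deg-as-∑ H v = trans (degIn-as-∑ H (allE H) v)
  (∑-cong (λ e → cong (λ b → χ (b ∧ does (v ∈? inc H e))) (lookup-∈ (∈⊤ {x = e}))))

-- No edge has all its ends at a single vertex; so a one-vertex hypergraph
-- has no edges at all.
¬edge-at-one-vertex : ∀ H e (v : Vtx H) → ¬ (∀ x → x ∈ inc H e → x ≡ v)
¬edge-at-one-vertex H e v all≡v = ℕP.<-irrefl refl (ℕP.≤-trans (inc≥2 H e) (⊆single⇒∣∣≤1 (inc H e) v all≡v))

deg-one-vertex : ∀ H (v : Vtx H) → (∀ w → w ≡ v) → deg H v ≡ 0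
deg-one-vertex H v only-v = trans (deg-as-∑ H v) (∑-zero (λ e → ⊥-elim (¬edge-at-one-vertex H e v (λ x _ → only-v x))))

joins : (H : Hypergraph) → Edg H → Vtx H → Vtx H → Bool
joins H e x y = does (VP.≡-dec BP._≟_ (inc H e) (⁅ x ⁆ ∪ ⁅ y ⁆))

mult-as-∑ : ∀ H x y → mult H x y ≡ ∑ (λ e → χ (joins H e x y))
mult-as-∑ H x y =
  trans ∣ tabulate (λ e → joins H e x y) ∣-as-∑ (∑-cong (λ e → cong χ (VP.lookup∘tabulate (λ e → joins H e x y) e)))

¬joins-self : ∀ H e x → joins H e x x ≡ false
¬joins-self H e x = dec-false (VP.≡-dec BP._≟_ (inc H e) (⁅ x ⁆ ∪ ⁅ x ⁆)) λ e≡xx →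
  ¬edge-at-one-vertex H e x (λ y y∈ → Data.Sum.reduce (∈pair⇒ (subst (y ∈_) e≡xx y∈)))

mult-self : ∀ H x → mult H x x ≡ 0
mult-self H x = trans (mult-as-∑ H x x) (∑-zero (λ e → cong χ (¬joins-self H e x)))

ordinary-incidence : ∀ H e v → ∣ inc H e ∣ ≡ 2 → χ (does (v ∈? inc H e)) ≡ ∑ (λ y → χ (joins H e v y))
ordinary-incidence H e v ordinary with v ∈? inc H e
... | no v∉e = sym (∑-zero (λ y → cong χ (dec-false (VP.≡-dec BP._≟_ (inc H e) (⁅ v ⁆ ∪ ⁅ y ⁆))
                 (λ eq → v∉e (subst (v ∈_) (sym eq) (∈pairˡ v y))))))
... | yes v∈e with ∣∣≥2⇒other (inc H e) v (ℕP.≤-reflexive (sym ordinary))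
... | w , w∈e , w≢v =
  sym (trans (∑-single w only-w) (cong χ (dec-true (VP.≡-dec BP._≟_ (inc H e) (⁅ v ⁆ ∪ ⁅ w ⁆)) (sym e≡vw))))
  where
  e≡vw : ⁅ v ⁆ ∪ ⁅ w ⁆ ≡ inc H e
  e≡vw = ⊆-∣∣≥⇒≡ (pair⊆ v∈e w∈e)
           (subst (_≤ ∣ ⁅ v ⁆ ∪ ⁅ w ⁆ ∣) (sym ordinary)
             (two⇒∣∣≥2 (∈pairˡ v w) (∈pairʳ v w) (λ v≡w → w≢v (sym v≡w))))
  only-w : ∀ y → y ≢ w → χ (joins H e v y) ≡ 0
  only-w y y≢w with y FP.≟ v
  ... | yes refl = cong χ (¬joins-self H e y)
  ... | no y≢v = cong χ (dec-false (VP.≡-dec BP._≟_ (inc H e) (⁅ v ⁆ ∪ ⁅ y ⁆)) λ eq →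
        [ y≢v , y≢w ]′ (∈pair⇒ (subst (y ∈_) (trans (sym eq) (sym e≡vw)) (∈pairʳ v y))))

deg-as-mult : ∀ H → AllOrdinary H → ∀ v → deg H v ≡ ∑ (λ y → mult H v y)
deg-as-mult H ordinary v = begin
  deg H v                                   ≡⟨ deg-as-∑ H v ⟩
  ∑ (λ e → χ (does (v ∈? inc H e)))         ≡⟨ ∑-cong (λ e → ordinary-incidence H e v (ordinary e)) ⟩
  ∑ (λ e → ∑ (λ y → χ (joins H e v y)))     ≡⟨ ∑-comm (λ e y → χ (joins H e v y)) ⟩
  ∑ (λ y → ∑ (λ e → χ (joins H e v y)))     ≡⟨ ∑-cong (λ y → sym (mult-as-∑ H v y)) ⟩
  ∑ (λ y → mult H v y)                      ∎
  where open ≡-Reasoning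

-- Degrees in tK_n: every vertex has degree t(n-1), stated without subtraction.

deg-tK : ∀ {t n} H → IsTK t n H → ∀ v → deg H v + t ≡ n * t
deg-tK {t} {n} H (|V|≡n , ordinary , mult≡t) v = begin
  deg H v + t                                                 ≡⟨ cong₂ _+_ (deg-as-mult H ordinary v) (sym (∑-indicator v t)) ⟩
  ∑ (λ y → mult H v y) + ∑ (λ y → χ (does (y FP.≟ v)) * t)    ≡⟨ sym (∑-distrib-+ (λ y → mult H v y) _) ⟩
  ∑ (λ y → mult H v y + χ (does (y FP.≟ v)) * t)              ≡⟨ ∑-cong each-t ⟩
  ∑ {nV H} (λ _ → t)                                          ≡⟨ ∑-const (nV H) t ⟩
  nV H * t                                                    ≡⟨ cong (_* t) |V|≡n ⟩
  n * t                                                       ∎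
  where
  open ≡-Reasoning
  each-t : ∀ y → mult H v y + χ (does (y FP.≟ v)) * t ≡ t
  each-t y with y FP.≟ v
  ... | yes refl = trans (cong (_+ (t + 0)) (mult-self H y)) (ℕP.+-identityʳ t)
  ... | no y≢v   = trans (cong (_+ 0) (mult≡t v y (λ v≡y → y≢v (sym v≡y)))) (ℕP.+-identityʳ t)

injective⇒surjective : ∀ {N} (σ : Fin N → Fin N) → (∀ i j → σ i ≡ σ j → i ≡ j) → ∀ y → ∃[ j ] σ j ≡ y
injective⇒surjective {zero}  σ inj ()
injective⇒surjective {suc N} σ inj y with FP.any? (λ j → σ j FP.≟ y)
... | yes found = found
... | no ¬found = ⊥-elim (ℕP.<-irrefl refl (FP.injective⇒≤ {f = squeeze} squeeze-injective))
  where
  avoids : ∀ j → y ≢ σ j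
  avoids j y≡σj = ¬found (j , sym y≡σj)
  squeeze : Fin (suc N) → Fin N
  squeeze j = Data.Fin.punchOut (avoids j)
  squeeze-injective : ∀ {a b} → squeeze a ≡ squeeze b → a ≡ b
  squeeze-injective {a} {b} eq = inj a b (FP.punchOut-injective (avoids a) (avoids b) eq)

successor : ∀ {N} (i : Fin N) → ∃[ j ] CycSucc N i j
successor {suc N} i with suc (toℕ i) ℕP.<? suc N
... | yes lt  = Data.Fin.fromℕ< lt , inj₁ (sym (FP.toℕ-fromℕ< lt))
... | no ¬lt  = zero , inj₂ (ℕP.≤-antisym (FP.toℕ<n i) (ℕP.≮⇒≥ ¬lt) , refl)

predecessor : ∀ {N} (i : Fin N) → ∃[ j ] CycSucc N j i
predecessor {suc N} zero    = Data.Fin.fromℕ N , inj₂ (cong suc (FP.toℕ-fromℕ N) , refl)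
predecessor {suc N} (suc i) = Data.Fin.inject₁ i , inj₁ (cong suc (FP.toℕ-inject₁ i))

successor-unique : ∀ {N} {i j j' : Fin N} → CycSucc N i j → CycSucc N i j' → j ≡ j'
successor-unique (inj₁ a) (inj₁ b) = FP.toℕ-injective (trans (sym a) b)
successor-unique {j = j} (inj₁ a) (inj₂ (b , _)) = ⊥-elim (ℕP.<-irrefl (trans (sym a) b) (FP.toℕ<n j))
successor-unique {j' = j'} (inj₂ (a , _)) (inj₁ b) = ⊥-elim (ℕP.<-irrefl (trans (sym b) a) (FP.toℕ<n j'))
successor-unique (inj₂ (_ , a)) (inj₂ (_ , b)) = FP.toℕ-injective (trans a (sym b))

predecessor-unique : ∀ {N} {i j j' : Fin N} → CycSucc N j i → CycSucc N j' i → j ≡ j'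
predecessor-unique (inj₁ a) (inj₁ b) = FP.toℕ-injective (ℕP.suc-injective (trans a (sym b)))
predecessor-unique (inj₁ a) (inj₂ (_ , b)) with trans a b
... | ()
predecessor-unique (inj₂ (_ , a)) (inj₁ b) with trans b a
... | ()
predecessor-unique (inj₂ (a , _)) (inj₂ (b , _)) = FP.toℕ-injective (ℕP.suc-injective (trans a (sym b)))

next : ∀ {N} → Fin N → Fin N
next i = proj₁ (successor i)

prev : ∀ {N} → Fin N → Fin N
prev i = proj₁ (predecessor i)

module Neighbours {N : ℕ} (N≥3 : 3 ≤ N) (i : Fin N) where

  private
    short : ∀ {k} → N ≡ k → k < 3 → ⊥
    short N≡k k<3 = ℕP.<-irrefl refl (ℕP.<-≤-trans k<3 (subst (3 ≤_) N≡k N≥3))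

    no-loop : ∀ {k : Fin N} → ¬ CycSucc N k k
    no-loop {k} (inj₁ a)       = ℕP.<-irrefl (sym a) (ℕP.n<1+n (toℕ k))
    no-loop (inj₂ (a , b))     = short (trans (sym a) (cong suc b)) (s≤s (s≤s z≤n))

    no-2-cycle : ∀ {a b : Fin N} → CycSucc N a b → CycSucc N b a → ⊥
    no-2-cycle {a} (inj₁ x) (inj₁ y) =
      ℕP.<-irrefl (trans (sym y) (cong suc (sym x))) (ℕP.≤-trans (ℕP.n<1+n (toℕ a)) (ℕP.n≤1+n _))
    no-2-cycle (inj₁ x) (inj₂ (y , z)) = short (trans (sym y) (cong suc (trans (sym x) (cong suc z)))) (s≤s (s≤s (s≤s z≤n)))
    no-2-cycle (inj₂ (y , z)) (inj₁ x) = short (trans (sym y) (cong suc (trans (sym x) (cong suc z)))) (s≤s (s≤s (s≤s z≤n)))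
    no-2-cycle (inj₂ (y , _)) (inj₂ (_ , z')) = short (trans (sym y) (cong suc z')) (s≤s (s≤s z≤n))

  next≢i : next i ≢ i
  next≢i eq = no-loop (subst (CycSucc N i) eq (proj₂ (successor i)))

  prev≢i : prev i ≢ i
  prev≢i eq = no-loop (subst (λ k → CycSucc N k i) eq (proj₂ (predecessor i)))

  next≢prev : next i ≢ prev i
  next≢prev eq = no-2-cycle (proj₂ (successor i)) (subst (λ k → CycSucc N k i) (sym eq) (proj₂ (predecessor i)))

  adjacent⇒next⊎prev : ∀ j → CycAdj N i j → j ≡ next i ⊎ j ≡ prev i
  adjacent⇒next⊎prev j (inj₁ s) = inj₁ (successor-unique s (proj₂ (successor i)))
  adjacent⇒next⊎prev j (inj₂ s) = inj₂ (predecessor-unique s (proj₂ (predecessor i)))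

deg-tC : ∀ {t n} H → IsTC t n H → 3 ≤ n → ∀ v → deg H v ≡ t + t
deg-tC {t} {n} H (|V|≡n , ordinary , σ , σ-inj , mults) n≥3 v with injective⇒surjective σ σ-inj v
... | i , refl = begin
  deg H (σ i)                                       ≡⟨ deg-as-mult H ordinary (σ i) ⟩
  ∑ (λ y → mult H (σ i) y)
    ≡⟨ ∑-pair (σ (next i)) (σ (prev i)) (λ eq → next≢prev (σ-inj _ _ eq)) others ⟩
  mult H (σ i) (σ (next i)) + mult H (σ i) (σ (prev i))
    ≡⟨ cong₂ _+_ (proj₁ (mults i (next i) (λ q → next≢i (sym q))) (inj₁ (proj₂ (successor i))))
                 (proj₁ (mults i (prev i) (λ q → prev≢i (sym q))) (inj₂ (proj₂ (predecessor i)))) ⟩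
  t + t                                             ∎
  where
  open ≡-Reasoning
  open Neighbours (subst (3 ≤_) (sym |V|≡n) n≥3) i
  others : ∀ y → y ≢ σ (next i) → y ≢ σ (prev i) → mult H (σ i) y ≡ 0
  others y y≢n y≢p with injective⇒surjective σ σ-inj y
  ... | j , refl with j FP.≟ i
  ... | yes refl = mult-self H (σ j)
  ... | no j≢i   = proj₂ (mults i j (λ q → j≢i (sym q)))
                     (λ adj → [ (λ e → y≢n (cong σ e)) , (λ e → y≢p (cong σ e)) ]′ (adjacent⇒next⊎prev j adj))

flips : ℕ → Bool → Bool
flips zero    b = b
flips (suc m) b = not (flips m b)

flips-even : ∀ k b → flips (2 * k) b ≡ b
flips-even zero    b = refl
flips-even (suc k) b =
  trans (cong (λ m → flips m b) (ℕP.*-distribˡ-+ 2 1 k))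
        (trans (BP.not-involutive (flips (2 * k) b)) (flips-even k b))

odd-cycle-not-bipartite : ∀ {N} → Odd N → (colour : Fin N → Bool) →
                          ¬ (∀ i → colour (next i) ≡ not (colour i))
odd-cycle-not-bipartite (k , refl) colour alternates =
  not-fixed (colour zero) (begin
    colour zero                          ≡⟨ cong colour (sym next-last) ⟩
    colour (next last)                   ≡⟨ alternates last ⟩
    not (colour last)                    ≡⟨ cong not (colour-at (2 * k) last (FP.toℕ-fromℕ (2 * k))) ⟩
    not (flips (2 * k) (colour zero))    ≡⟨ cong not (flips-even k (colour zero)) ⟩
    not (colour zero)                    ∎)
  where
  open ≡-Reasoning
  last : Fin (suc (2 * k))
  last = Data.Fin.fromℕ (2 * k)
  next-last : next last ≡ zero
  next-last = successor-unique (proj₂ (successor last)) (inj₂ (cong suc (FP.toℕ-fromℕ (2 * k)) , refl))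
  not-fixed : ∀ b → b ≢ not b
  not-fixed true ()
  not-fixed false ()
  colour-at : ∀ m j → toℕ j ≡ m → colour j ≡ flips m (colour zero)
  colour-at zero j j≡0 = cong colour (FP.toℕ-injective {j = zero} j≡0)
  colour-at (suc m) j j≡m+1 with proj₂ (predecessor j)
  ... | inj₂ (_ , j≡0) with trans (sym j≡m+1) j≡0
  ... | ()
  colour-at (suc m) j j≡m+1 | inj₁ s = begin
    colour j                    ≡⟨ cong colour (sym (successor-unique (proj₂ (successor (prev j))) (inj₁ s))) ⟩
    colour (next (prev j))      ≡⟨ alternates (prev j) ⟩
    not (colour (prev j))       ≡⟨ cong not (colour-at m (prev j) (ℕP.suc-injective (trans s j≡m+1))) ⟩
    flips (suc m) (colour zero) ∎

-- Unlike `MergeData` this is invariant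
-- under exchanging the halves (`swap`), which halves the case analysis.
record Merge (H¹ H² H : Hypergraph) (v¹ : Vtx H¹) (v² : Vtx H²) : Set where
  field
    φ₁ : Vtx H¹ → Vtx H
    φ₂ : Vtx H² → Vtx H
    φ₁-inj : ∀ a b → φ₁ a ≡ φ₁ b → a ≡ b
    φ₂-inj : ∀ a b → φ₂ a ≡ φ₂ b → a ≡ b
    glue : φ₁ v¹ ≡ φ₂ v²
    meet : ∀ a b → φ₁ a ≡ φ₂ b → a ≡ v¹ × b ≡ v²
    vertex-cover : ∀ x → (∃[ a ] φ₁ a ≡ x) ⊎ (∃[ b ] φ₂ b ≡ x)
    ε₁ : Edg H¹ → Edg H
    ε₂ : Edg H² → Edg H
    origin : Edg H → Edg H¹ ⊎ Edg H²
    origin₁ : ∀ e → origin (ε₁ e) ≡ inj₁ e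
    origin₂ : ∀ e → origin (ε₂ e) ≡ inj₂ e
    edge-cover : ∀ e → (∃[ e₁ ] ε₁ e₁ ≡ e) ⊎ (∃[ e₂ ] ε₂ e₂ ≡ e)
    ∑-edges : ∀ (g : Edg H → ℕ) → ∑ g ≡ ∑ (λ e → g (ε₁ e)) + ∑ (λ e → g (ε₂ e))
    inc₁⁺ : ∀ e a → a ∈ inc H¹ e → φ₁ a ∈ inc H (ε₁ e)
    inc₁⁻ : ∀ e a → φ₁ a ∈ inc H (ε₁ e) → a ∈ inc H¹ e
    inc₁⊆ : ∀ e x → x ∈ inc H (ε₁ e) → ∃[ a ] φ₁ a ≡ x
    inc₂⁺ : ∀ e b → b ∈ inc H² e → φ₂ b ∈ inc H (ε₂ e)
    inc₂⁻ : ∀ e b → φ₂ b ∈ inc H (ε₂ e) → b ∈ inc H² e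
    inc₂⊆ : ∀ e x → x ∈ inc H (ε₂ e) → ∃[ b ] φ₂ b ≡ x

swap : ∀ {H¹ H² H v¹ v²} → Merge H¹ H² H v¹ v² → Merge H² H¹ H v² v¹
swap m = record
  { φ₁ = φ₂ ; φ₂ = φ₁ ; φ₁-inj = φ₂-inj ; φ₂-inj = φ₁-inj ; glue = sym glue
  ; meet = λ a b eq → Data.Product.swap (meet b a (sym eq))
  ; vertex-cover = λ x → Data.Sum.swap (vertex-cover x)
  ; ε₁ = ε₂ ; ε₂ = ε₁ ; origin = λ e → Data.Sum.swap (origin e)
  ; origin₁ = λ e → cong Data.Sum.swap (origin₂ e)
  ; origin₂ = λ e → cong Data.Sum.swap (origin₁ e)
  ; edge-cover = λ e → Data.Sum.swap (edge-cover e)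
  ; ∑-edges = λ g → trans (∑-edges g) (ℕP.+-comm (∑ (λ e → g (ε₁ e))) _)
  ; inc₁⁺ = inc₂⁺ ; inc₁⁻ = inc₂⁻ ; inc₁⊆ = inc₂⊆
  ; inc₂⁺ = inc₁⁺ ; inc₂⁻ = inc₁⁻ ; inc₂⊆ = inc₁⊆ }
  where open Merge m

fromMergeData : ∀ {H¹ H² H v¹ v²} → MergeData H¹ H² H v¹ v² → Merge H¹ H² H v¹ v²
fromMergeData {H¹} {H²} {H} {v¹} {v²} m = record
  { φ₁ = φ₁ ; φ₂ = φ₂ ; φ₁-inj = φ₁-inj ; φ₂-inj = φ₂-inj ; glue = glue
  ; meet = λ a b eq → let a≡v¹ = meet-at a b eq in
       a≡v¹ , φ₂-inj b v² (trans (sym eq) (trans (cong φ₁ a≡v¹) glue))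
  ; vertex-cover = cover
  ; ε₁ = λ e → to (inj₁ e) ; ε₂ = λ e → to (inj₂ e) ; origin = from
  ; origin₁ = λ e → strictlyInverseʳ (inj₁ e)
  ; origin₂ = λ e → strictlyInverseʳ (inj₂ e)
  ; edge-cover = edge-cover
  ; ∑-edges = ∑-edges
  ; inc₁⁺ = λ e a → proj₁ (inc₁ e a) ; inc₁⁻ = λ e a → proj₂ (inc₁ e a) ; inc₁⊆ = inc₁⊆
  ; inc₂⁺ = λ e b → proj₁ (inc₂ e b) ; inc₂⁻ = λ e b → proj₂ (inc₂ e b) ; inc₂⊆ = inc₂⊆ }
  where
  open MergeData m
  open Inverse ψ
  edge-cover : ∀ e → (∃[ e₁ ] to (inj₁ e₁) ≡ e) ⊎ (∃[ e₂ ] to (inj₂ e₂) ≡ e)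
  edge-cover e with from e in eq
  ... | inj₁ e₁ = inj₁ (e₁ , trans (cong to (sym eq)) (strictlyInverseˡ e))
  ... | inj₂ e₂ = inj₂ (e₂ , trans (cong to (sym eq)) (strictlyInverseˡ e))
  ∑-edges : ∀ (g : Edg H → ℕ) → ∑ g ≡ ∑ (λ e → g (to (inj₁ e))) + ∑ (λ e → g (to (inj₂ e)))
  ∑-edges g = begin
    ∑ g                                     ≡⟨ ∑-permute g (ψ ↔-∘ FP.+↔⊎) ⟩
    ∑ (λ i → g (to (splitAt i)))            ≡⟨ ∑-splitAt (nE H¹) (nE H²) _ ⟩
    ∑ (λ i → g (to (splitAt (i ↑ˡ nE H²)))) + ∑ (λ j → g (to (splitAt (nE H¹ ↑ʳ j))))
      ≡⟨ cong₂ _+_ (∑-cong (λ i → cong (λ z → g (to z)) (FP.splitAt-↑ˡ (nE H¹) i (nE H²))))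
                   (∑-cong (λ j → cong (λ z → g (to z)) (FP.splitAt-↑ʳ (nE H¹) (nE H²) j))) ⟩
    ∑ (λ e → g (to (inj₁ e))) + ∑ (λ e → g (to (inj₂ e)))      ∎
    where
    open ≡-Reasoning
    splitAt = Data.Fin.splitAt (nE H¹) {nE H²}

-- For edge sets F of H, F₁ of H¹, F₂ of H² with F
-- restricting to F₁ and F₂, the degree of φ₁ a splits into its degree in H¹
-- and the number of F₂-edges through it, which vanishes unless a = v¹.
module MergeDegrees {H¹ H² H : Hypergraph} {v¹ : Vtx H¹} {v² : Vtx H²} (m : Merge H¹ H² H v¹ v²) where
  open Merge m

  through₂ : ESet H² → Vtx H → ℕ
  through₂ F₂ x = ∑ (λ e → χ (lookup F₂ e ∧ does (x ∈? inc H (ε₂ e))))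

  degIn-split : (F : ESet H) (F₁ : ESet H¹) (F₂ : ESet H²) →
                (∀ e → lookup F (ε₁ e) ≡ lookup F₁ e) → (∀ e → lookup F (ε₂ e) ≡ lookup F₂ e) →
                ∀ a → degIn H F (φ₁ a) ≡ degIn H¹ F₁ a + through₂ F₂ (φ₁ a)
  degIn-split F F₁ F₂ F≡F₁ F≡F₂ a = begin
    degIn H F (φ₁ a)
      ≡⟨ degIn-as-∑ H F (φ₁ a) ⟩
    ∑ (λ e → χ (lookup F e ∧ does (φ₁ a ∈? inc H e)))
      ≡⟨ ∑-edges _ ⟩
    ∑ (λ e → χ (lookup F (ε₁ e) ∧ does (φ₁ a ∈? inc H (ε₁ e))))
      + ∑ (λ e → χ (lookup F (ε₂ e) ∧ does (φ₁ a ∈? inc H (ε₂ e))))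
      ≡⟨ cong₂ _+_ (∑-cong (λ e → cong₂ (λ u w → χ (u ∧ w)) (F≡F₁ e)
                                    (does-⇔ (φ₁ a ∈? inc H (ε₁ e)) (a ∈? inc H¹ e) (inc₁⁻ e a) (inc₁⁺ e a))))
                   (∑-cong (λ e → cong (λ u → χ (u ∧ does (φ₁ a ∈? inc H (ε₂ e)))) (F≡F₂ e))) ⟩
    ∑ (λ e → χ (lookup F₁ e ∧ does (a ∈? inc H¹ e))) + through₂ F₂ (φ₁ a)
      ≡⟨ cong (_+ through₂ F₂ (φ₁ a)) (sym (degIn-as-∑ H¹ F₁ a)) ⟩
    degIn H¹ F₁ a + through₂ F₂ (φ₁ a)  ∎
    where open ≡-Reasoning

  through₂-away : ∀ F₂ a → a ≢ v¹ → through₂ F₂ (φ₁ a) ≡ 0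
  through₂-away F₂ a a≢v¹ = ∑-zero λ e → cong χ (trans
      (cong (lookup F₂ e ∧_) (dec-false (φ₁ a ∈? inc H (ε₂ e)) (λ φ₁a∈ → a≢v¹ (a≡v¹ e φ₁a∈))))
      (BP.∧-zeroʳ _))
    where
    a≡v¹ : ∀ e → φ₁ a ∈ inc H (ε₂ e) → a ≡ v¹
    a≡v¹ e φ₁a∈ with inc₂⊆ e (φ₁ a) φ₁a∈
    ... | b , φ₂b≡φ₁a = proj₁ (meet a b (sym φ₂b≡φ₁a))

  through₂-glued : ∀ F₂ → through₂ F₂ (φ₁ v¹) ≡ degIn H² F₂ v²
  through₂-glued F₂ = trans
    (∑-cong (λ e → cong (λ u → χ (lookup F₂ e ∧ u))
      (does-⇔ (φ₁ v¹ ∈? inc H (ε₂ e)) (v² ∈? inc H² e)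
              (λ φ₁v¹∈ → inc₂⁻ e v² (subst (_∈ inc H (ε₂ e)) glue φ₁v¹∈))
              (λ v²∈ → subst (_∈ inc H (ε₂ e)) (sym glue) (inc₂⁺ e v² v²∈)))))
    (sym (degIn-as-∑ H² F₂ v²))

  private
    all₁ : ∀ e → lookup (allE H) (ε₁ e) ≡ lookup (allE H¹) e
    all₁ e = trans (lookup-∈ (∈⊤ {x = ε₁ e})) (sym (lookup-∈ (∈⊤ {x = e})))
    all₂ : ∀ e → lookup (allE H) (ε₂ e) ≡ lookup (allE H²) e
    all₂ e = trans (lookup-∈ (∈⊤ {x = ε₂ e})) (sym (lookup-∈ (∈⊤ {x = e})))

  deg-away : ∀ a → a ≢ v¹ → deg H (φ₁ a) ≡ deg H¹ a
  deg-away a a≢v¹ = trans (degIn-split (allE H) (allE H¹) (allE H²) all₁ all₂ a)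
    (trans (cong (deg H¹ a +_) (through₂-away (allE H²) a a≢v¹)) (ℕP.+-identityʳ _))

  deg-glued : deg H (φ₁ v¹) ≡ deg H¹ v¹ + deg H² v²
  deg-glued = trans (degIn-split (allE H) (allE H¹) (allE H²) all₁ all₂ v¹)
    (cong (deg H¹ v¹ +_) (through₂-glued (allE H²)))

record MergedLabels {p} {H¹ H² H : Hypergraph} {v¹ : Vtx H¹} {v² : Vtx H²} (m : Merge H¹ H² H v¹ v²)
                    (f : Vtx H → Vec ℕ p) (f¹ : Vtx H¹ → Vec ℕ p) (f² : Vtx H² → Vec ℕ p) : Set where
  open Merge m
  field
    away₁ : ∀ a → a ≢ v¹ → f (φ₁ a) ≡ f¹ a
    away₂ : ∀ b → b ≢ v² → f (φ₂ b) ≡ f² b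
    glued : f (φ₁ v¹) ≡ zipWith _+_ (f¹ v¹) (f² v²)

swapLabels : ∀ {p H¹ H² H v¹ v²} {m : Merge H¹ H² H v¹ v²} {f : Vtx H → Vec ℕ p} {f¹ f²} →
             MergedLabels m f f¹ f² → MergedLabels (swap m) f f² f¹
swapLabels {m = m} {f} {f¹} {f²} ℓ = record
  { away₁ = away₂ ; away₂ = away₁
  ; glued = trans (cong f (sym glue)) (trans glued (zipWith-+-comm (f¹ _) (f² _))) }
  where
  open MergedLabels ℓ
  open Merge m

labelsOf : ∀ {p H¹ H² H v¹ v²} (md : MergeData H¹ H² H v¹ v²) (f : Vtx H → Vec ℕ p) f¹ f² →
           (∀ a → a ≢ v¹ → f (MergeData.φ₁ md a) ≡ f¹ a) → (∀ b → b ≢ v² → f (MergeData.φ₂ md b) ≡ f² b) →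
           f (MergeData.φ₁ md v¹) ≡ zipWith _+_ (f¹ v¹) (f² v²) → MergedLabels (fromMergeData md) f f¹ f²
labelsOf md f f¹ f² away₁ away₂ glued = record { away₁ = away₁ ; away₂ = away₂ ; glued = glued }

on-both-halves : ∀ {H¹ H² H v¹ v²} (m : Merge H¹ H² H v¹ v²) {P : Vtx H → Set} →
                 (∀ a → P (Merge.φ₁ m a)) → (∀ b → P (Merge.φ₂ m b)) → ∀ x → P x
on-both-halves m P₁ P₂ x with Merge.vertex-cover m x
... | inj₁ (a , refl) = P₁ a
... | inj₂ (b , refl) = P₂ b

merge-degree-sum₁ : ∀ {p H¹ H² H v¹ v²} (m : Merge H¹ H² H v¹ v²) {f : Vtx H → Vec ℕ p} {f¹ f²} →
                    MergedLabels m f f¹ f² → (∀ a → sum (f¹ a) ≡ deg H¹ a) → (∀ b → sum (f² b) ≡ deg H² b) →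
                    ∀ a → sum (f (Merge.φ₁ m a)) ≡ deg H (Merge.φ₁ m a)
merge-degree-sum₁ {p} {H¹} {H²} {H} {v¹} {v²} m {f} {f¹} {f²} ℓ sum¹ sum² a with a FP.≟ v¹
... | yes refl = begin
  sum (f (φ₁ a))                      ≡⟨ cong sum glued ⟩
  sum (zipWith _+_ (f¹ a) (f² v²))    ≡⟨ sum-zipWith-+ (f¹ a) (f² v²) ⟩
  sum (f¹ a) + sum (f² v²)            ≡⟨ cong₂ _+_ (sum¹ a) (sum² v²) ⟩
  deg H¹ a + deg H² v²                ≡⟨ sym deg-glued ⟩
  deg H (φ₁ a)                        ∎
  where
  open ≡-Reasoning
  open Merge m
  open MergedLabels ℓ
  open MergeDegrees m
... | no a≢v¹ = trans (cong sum (away₁ a a≢v¹)) (trans (sum¹ a) (sym (deg-away a a≢v¹)))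
  where
  open MergedLabels ℓ
  open MergeDegrees m

degree-sum : ∀ {p} {H : Hypergraph} {f : Vtx H → Vec ℕ p} → Hard {p} H f → ∀ v → sum (f v) ≡ deg H v
degree-sum (hard-M H f _ j f-shape) v = begin
  sum (f v)              ≡⟨ sum-as-∑ (f v) ⟩
  ∑ (lookup (f v))       ≡⟨ ∑-single j (λ i i≢j → proj₂ (f-shape v i) i≢j) ⟩
  lookup (f v) j         ≡⟨ proj₁ (f-shape v j) refl ⟩
  deg H v                ∎
  where open ≡-Reasoning
degree-sum (hard-K H f t n _ _ tK ns ∑ns+1≡n _ f≡tns) v = begin
  sum (f v)              ≡⟨ cong sum (f≡tns v) ⟩
  sum (map (t *_) ns)    ≡⟨ sum-map-* t ns ⟩
  t * sum ns             ≡⟨ ℕP.+-cancelʳ-≡ t _ _ deg+t ⟩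
  deg H v                ∎
  where
  open ≡-Reasoning
  deg+t : t * sum ns + t ≡ deg H v + t
  deg+t = begin
    t * sum ns + t       ≡⟨ cong₂ _+_ (ℕP.*-comm t (sum ns)) (sym (ℕP.*-identityˡ t)) ⟩
    sum ns * t + 1 * t   ≡⟨ sym (ℕP.*-distribʳ-+ t (sum ns) 1) ⟩
    (sum ns + 1) * t     ≡⟨ cong (_* t) ∑ns+1≡n ⟩
    n * t                ≡⟨ sym (deg-tK H tK v) ⟩
    deg H v + t          ∎
degree-sum (hard-C H f t n _ n≥5 _ tC k ℓ k≢ℓ f-shape) v = begin
  sum (f v)                        ≡⟨ sum-as-∑ (f v) ⟩
  ∑ (lookup (f v))                 ≡⟨ ∑-pair k ℓ k≢ℓ (λ i i≢k i≢ℓ → proj₂ (f-shape v i) i≢k i≢ℓ) ⟩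
  lookup (f v) k + lookup (f v) ℓ  ≡⟨ cong₂ _+_ (proj₁ (f-shape v k) (inj₁ refl)) (proj₁ (f-shape v ℓ) (inj₂ refl)) ⟩
  t + t                            ≡⟨ sym (deg-tC H tC (ℕP.≤-trans (s≤s (s≤s (s≤s z≤n))) n≥5) v) ⟩
  deg H v                          ∎
  where open ≡-Reasoning
degree-sum (hard-merge H¹ f¹ H² f² H f v¹ v² hard¹ hard² md away₁ away₂ glued) =
  on-both-halves m (merge-degree-sum₁ m ℓ sum¹ sum²) (merge-degree-sum₁ (swap m) (swapLabels ℓ) sum² sum¹)
  where
  m = fromMergeData md
  ℓ = labelsOf md f f¹ f² away₁ away₂ glued
  sum¹ = degree-sum hard¹
  sum² = degree-sum hard²

-- The classes X₁,…,X_p of a would-be f-partition are pairwise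
-- disjoint and cover V(H); an obstruction is a nonempty subhypergraph inside
-- one class X_i in which every vertex v has degree ≥ f_i(v).  It contradicts
-- strict f_i-degeneracy of H[X_i], and we construct one for every such cover.

Disjoint : ∀ {p} (H : Hypergraph) → (Fin p → VSet H) → Set
Disjoint {p} H X = ∀ i j → i ≢ j → ∀ v → v ∈ X i → v ∉ X j

Covering : ∀ {p} (H : Hypergraph) → (Fin p → VSet H) → Set
Covering {p} H X = ∀ v → ∃[ i ] (v ∈ X i)

Heavy : (H : Hypergraph) → (Vtx H → ℕ) → VSet H → ESet H → Set
Heavy H g Y F = IsSub H Y F × (∀ v → v ∈ Y → g v ≤ degIn H F v)

record Obstruction {p} (H : Hypergraph) (f : Vtx H → Vec ℕ p) (X : Fin p → VSet H) : Set where
  constructor obstruction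
  field
    class    : Fin p
    vertices : VSet H
    edges    : ESet H
    heavy    : Heavy H (λ v → lookup (f v) class) vertices edges
    inside   : vertices ⊆ X class
    nonempty : Nonempty vertices

obstruction⇒¬degenerate : ∀ {p} {H : Hypergraph} {f : Vtx H → Vec ℕ p} {X} → Obstruction H f X →
                          ¬ (∀ i → StrictlyDegenerate H (X i) (λ v → lookup (f v) i))
obstruction⇒¬degenerate (obstruction i Y F (sub , heavy) Y⊆Xᵢ ne) degenerate
  with degenerate i Y F sub Y⊆Xᵢ ne
... | v , v∈Y , d<f = ℕP.<-irrefl refl (ℕP.<-≤-trans d<f (heavy v v∈Y))

zero-obstruction : ∀ {p} {H : Hypergraph} {f : Vtx H → Vec ℕ p} {X} v i → v ∈ X i → lookup (f v) i ≡ 0 →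
                   Obstruction H f X
zero-obstruction {H = H} {f} {X} v i v∈Xᵢ fᵢv≡0 =
  obstruction i ⁅ v ⁆ ∅ ((λ e e∈⊥ → ⊥-elim (∉⊥ e∈⊥)) , heavy)
    (λ w∈ → subst (_∈ X i) (sym (∈⁅⁆⇒≡ w∈)) v∈Xᵢ) (v , x∈⁅x⁆ v)
  where
  heavy : ∀ w → w ∈ ⁅ v ⁆ → lookup (f w) i ≤ degIn H ∅ w
  heavy w w∈ rewrite ∈⁅⁆⇒≡ w∈ | fᵢv≡0 = z≤n

-- (M): either one class is all of V(H), and H itself is the obstruction, or
-- some vertex lies in a class where f vanishes.
obstruction-M : ∀ {p} (H : Hypergraph) (f : Vtx H → Vec ℕ p) → Nonempty (allV H) → (j : Fin p) →
                (∀ v i → (i ≡ j → lookup (f v) i ≡ deg H v) × (i ≢ j → lookup (f v) i ≡ 0)) →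
                ∀ X → Covering H X → Obstruction H f X
obstruction-M H f ne j f-shape X cover with FP.all? (λ v → v ∈? X j)
... | yes all∈Xⱼ = obstruction j (allV H) (allE H) ((λ _ _ _ → ∈⊤) , (λ v _ → ℕP.≤-reflexive (proj₁ (f-shape v j) refl)))
                     (λ {v} _ → all∈Xⱼ v) ne
... | no ¬all with FP.¬∀⟶∃¬ _ (λ v → v ∈ X j) (λ v → v ∈? X j) ¬all
... | v , v∉Xⱼ with cover v
... | i , v∈Xᵢ = zero-obstruction v i v∈Xᵢ (proj₂ (f-shape v i) (λ i≡j → v∉Xⱼ (subst (λ k → v ∈ X k) i≡j v∈Xᵢ)))

term≤∑ : ∀ {n} (f : Fin n → ℕ) j → f j ≤ ∑ f
term≤∑ f zero    = ℕP.m≤m+n (f zero) _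
term≤∑ f (suc j) = ℕP.≤-trans (term≤∑ (λ i → f (suc i)) j) (ℕP.m≤n+m _ (f zero))

∑-class-sizes : ∀ {p} (H : Hypergraph) (X : Fin p → VSet H) → Covering H X → nV H ≤ ∑ (λ i → ∣ X i ∣)
∑-class-sizes H X cover = begin
  nV H                                     ≡⟨ sym (trans (∑-const (nV H) 1) (ℕP.*-identityʳ _)) ⟩
  ∑ {nV H} (λ _ → 1)                       ≤⟨ ∑-mono in-some-class ⟩
  ∑ (λ v → ∑ (λ i → χ (lookup (X i) v)))   ≡⟨ ∑-comm (λ v i → χ (lookup (X i) v)) ⟩
  ∑ (λ i → ∑ (λ v → χ (lookup (X i) v)))   ≡⟨ ∑-cong (λ i → sym ∣ X i ∣-as-∑) ⟩
  ∑ (λ i → ∣ X i ∣)                        ∎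
  where
  open ℕP.≤-Reasoning
  in-some-class : ∀ v → 1 ≤ ∑ (λ i → χ (lookup (X i) v))
  in-some-class v with cover v
  ... | i , v∈Xᵢ = subst (λ b → χ b ≤ _) (lookup-∈ v∈Xᵢ) (term≤∑ (λ i → χ (lookup (X i) v)) i)

induced : (H : Hypergraph) → VSet H → ESet H
induced H X = tabulate (λ e → does (inc H e ⊆? X))

induced-sub : ∀ H X → IsSub H X (induced H X)
induced-sub H X e e∈ = ∈-tabulate (λ e → inc H e ⊆? X) e e∈

induced-degree : ∀ H → AllOrdinary H → (X : VSet H) → ∀ w → w ∈ X →
                 ∑ (λ y → mult H w y * χ (lookup X y)) ≤ degIn H (induced H X) w
induced-degree H ordinary X w w∈X = begin
  ∑ (λ y → mult H w y * χ (lookup X y))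
    ≡⟨ ∑-cong (λ y → trans (cong (_* χ (lookup X y)) (mult-as-∑ H w y)) (sym (∑-*ʳ (λ e → χ (joins H e w y)) _))) ⟩
  ∑ (λ y → ∑ (λ e → χ (joins H e w y) * χ (lookup X y)))
    ≡⟨ ∑-comm (λ y e → χ (joins H e w y) * χ (lookup X y)) ⟩
  ∑ (λ e → ∑ (λ y → χ (joins H e w y) * χ (lookup X y)))
    ≤⟨ ∑-mono (λ e → ∑-mono (λ y → joined-inside e y)) ⟩
  ∑ (λ e → ∑ (λ y → χ (joins H e w y) * χ (lookup F e)))
    ≡⟨ ∑-cong (λ e → ∑-*ʳ (λ y → χ (joins H e w y)) _) ⟩
  ∑ (λ e → ∑ (λ y → χ (joins H e w y)) * χ (lookup F e))
    ≡⟨ ∑-cong (λ e → cong (_* χ (lookup F e)) (sym (ordinary-incidence H e w (ordinary e)))) ⟩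
  ∑ (λ e → χ (does (w ∈? inc H e)) * χ (lookup F e))
    ≡⟨ ∑-cong (λ e → trans (ℕP.*-comm _ (χ (lookup F e))) (sym (χ-∧ (lookup F e) _))) ⟩
  ∑ (λ e → χ (lookup F e ∧ does (w ∈? inc H e)))
    ≡⟨ sym (degIn-as-∑ H F w) ⟩
  degIn H F w  ∎
  where
  open ℕP.≤-Reasoning
  F = induced H X
  joined-inside : ∀ e y → χ (joins H e w y) * χ (lookup X y) ≤ χ (joins H e w y) * χ (lookup F e)
  joined-inside e y with VP.≡-dec BP._≟_ (inc H e) (⁅ w ⁆ ∪ ⁅ y ⁆) | lookup X y in y∈X
  ... | no _  | _     = z≤n
  ... | yes _ | false = z≤n
  ... | yes e≡wy | true = ℕP.≤-reflexive (cong (λ b → 1 * χ b) (sym (lookup-∈ (tabulate-∈ (λ e → inc H e ⊆? X) e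
                            (subst (_⊆ X) (sym e≡wy) (pair⊆ w∈X (∈-lookup y∈X)))))))

induced-degree-tK : ∀ {t n} H → IsTK t n H → (X : VSet H) → ∀ w → w ∈ X →
                    ∣ X ∣ * t ≤ degIn H (induced H X) w + t
induced-degree-tK {t} H (_ , ordinary , mult≡t) X w w∈X = begin
  ∣ X ∣ * t                                                      ≡⟨ cong (_* t) ∣ X ∣-as-∑ ⟩
  ∑ (λ y → χ (lookup X y)) * t                                   ≡⟨ sym (∑-*ʳ (λ y → χ (lookup X y)) t) ⟩
  ∑ (λ y → χ (lookup X y) * t)                                   ≡⟨ ∑-cong split ⟩
  ∑ (λ y → mult H w y * χ (lookup X y) + χ (does (y FP.≟ w)) * t)
    ≡⟨ ∑-distrib-+ (λ y → mult H w y * χ (lookup X y)) (λ y → χ (does (y FP.≟ w)) * t) ⟩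
  ∑ (λ y → mult H w y * χ (lookup X y)) + ∑ (λ y → χ (does (y FP.≟ w)) * t)
    ≤⟨ ℕP.+-mono-≤ (induced-degree H ordinary X w w∈X) (ℕP.≤-reflexive (∑-indicator w t)) ⟩
  degIn H (induced H X) w + t                                    ∎
  where
  open ℕP.≤-Reasoning
  split : ∀ y → χ (lookup X y) * t ≡ mult H w y * χ (lookup X y) + χ (does (y FP.≟ w)) * t
  split y with y FP.≟ w
  ... | yes refl rewrite mult-self H y | lookup-∈ w∈X = refl
  ... | no y≢w rewrite mult≡t w y (λ w≡y → y≢w (sym w≡y)) =
        trans (ℕP.*-comm (χ (lookup X y)) t) (sym (ℕP.+-identityʳ _))

-- (K): by pigeonhole some class X_i has more than n_i vertices, and H[X_i] is
-- an obstruction since its degrees are t(|X_i| - 1) ≥ t·n_i = f_i.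
obstruction-K : ∀ {p} (H : Hypergraph) (f : Vtx H → Vec ℕ p) (t n : ℕ) → IsTK t n H →
                (ns : Vec ℕ p) → sum ns + 1 ≡ n → (∀ v → f v ≡ map (t *_) ns) →
                ∀ X → Covering H X → Obstruction H f X
obstruction-K H f t n tK@(|V|≡n , _) ns ∑ns+1≡n f≡tns X cover
  with FP.any? (λ i → lookup ns i ℕP.<? ∣ X i ∣)
... | no ¬big = ⊥-elim (ℕP.<-irrefl refl (begin-strict
  sum ns                   <⟨ ℕP.≤-reflexive (trans (ℕP.+-comm 1 (sum ns)) (trans ∑ns+1≡n (sym |V|≡n))) ⟩
  nV H                     ≤⟨ ∑-class-sizes H X cover ⟩
  ∑ (λ i → ∣ X i ∣)         ≤⟨ ∑-mono (λ i → ℕP.≮⇒≥ (λ lt → ¬big (i , lt))) ⟩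
  ∑ (lookup ns)            ≡⟨ sym (sum-as-∑ ns) ⟩
  sum ns                   ∎))
  where open ℕP.≤-Reasoning
... | yes (i , nᵢ<∣Xᵢ∣) = obstruction i (X i) (induced H (X i)) (induced-sub H (X i) , heavy) (λ x∈ → x∈) nonempty
  where
  nonempty : Nonempty (X i)
  nonempty with nonempty? (X i)
  ... | yes ne = ne
  ... | no ¬ne = ⊥-elim (ℕP.n≮0 (subst (lookup ns i <_) (empty⇒∣∣≡0 (X i) ¬ne) nᵢ<∣Xᵢ∣))
  heavy : ∀ w → w ∈ X i → lookup (f w) i ≤ degIn H (induced H (X i)) w
  heavy w w∈ = subst (_≤ degIn H (induced H (X i)) w) (sym fᵢw≡) (ℕP.+-cancelʳ-≤ t _ _ (begin
    lookup ns i * t + t      ≡⟨ ℕP.+-comm _ t ⟩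
    suc (lookup ns i) * t    ≤⟨ ℕP.*-monoˡ-≤ t nᵢ<∣Xᵢ∣ ⟩
    ∣ X i ∣ * t               ≤⟨ induced-degree-tK H tK (X i) w w∈ ⟩
    degIn H (induced H (X i)) w + t ∎))
    where
    open ℕP.≤-Reasoning
    fᵢw≡ : lookup (f w) i ≡ lookup ns i * t
    fᵢw≡ = trans (cong (λ z → lookup z i) (f≡tns w)) (trans (VP.lookup-map i (t *_) ns) (ℕP.*-comm t _))

odd-cycle-monochromatic-step : ∀ {N p} → Odd N → (c : Fin N → Fin p) (k ℓ : Fin p) →
                               (∀ i → c i ≡ k ⊎ c i ≡ ℓ) → ∃[ i ] c i ≡ c (next i)
odd-cycle-monochromatic-step odd c k ℓ two-valued with FP.any? (λ i → c i FP.≟ c (next i))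
... | yes found = found
... | no ¬same  = ⊥-elim (odd-cycle-not-bipartite odd colour alternates)
  where
  colour : _ → Bool
  colour i = does (c i FP.≟ k)
  alternates : ∀ i → colour (next i) ≡ not (colour i)
  alternates i with two-valued i | two-valued (next i)
  ... | inj₁ cᵢ≡k | inj₁ cₙ≡k = ⊥-elim (¬same (i , trans cᵢ≡k (sym cₙ≡k)))
  ... | inj₂ cᵢ≡ℓ | inj₂ cₙ≡ℓ = ⊥-elim (¬same (i , trans cᵢ≡ℓ (sym cₙ≡ℓ)))
  ... | inj₁ cᵢ≡k | inj₂ cₙ≡ℓ =
    trans (dec-false (c (next i) FP.≟ k) (λ cₙ≡k → ¬same (i , trans cᵢ≡k (sym cₙ≡k))))
          (cong not (sym (dec-true (c i FP.≟ k) cᵢ≡k)))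
  ... | inj₂ cᵢ≡ℓ | inj₁ cₙ≡k =
    trans (dec-true (c (next i) FP.≟ k) cₙ≡k)
          (cong not (sym (dec-false (c i FP.≟ k) (λ cᵢ≡k → ¬same (i , trans cᵢ≡k (sym cₙ≡k))))))

mult≤induced-degree : ∀ H → AllOrdinary H → (X : VSet H) → ∀ w y → w ∈ X → y ∈ X →
                      mult H w y ≤ degIn H (induced H X) w
mult≤induced-degree H ordinary X w y w∈X y∈X = begin
  mult H w y                               ≡⟨ sym (ℕP.*-identityʳ _) ⟩
  mult H w y * χ true                      ≡⟨ cong (λ b → mult H w y * χ b) (sym (lookup-∈ y∈X)) ⟩
  mult H w y * χ (lookup X y)              ≤⟨ term≤∑ (λ y → mult H w y * χ (lookup X y)) y ⟩
  ∑ (λ y → mult H w y * χ (lookup X y))    ≤⟨ induced-degree H ordinary X w w∈X ⟩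
  degIn H (induced H X) w                  ∎
  where open ℕP.≤-Reasoning

-- (C): a vertex in a class other than X_k, X_ℓ has f = 0 there.  Otherwise
-- all vertices lie in X_k ∪ X_ℓ, the odd cycle has two consecutive vertices
-- in one class, and the t parallel edges between them form an obstruction.
obstruction-C : ∀ {p} (H : Hypergraph) (f : Vtx H → Vec ℕ p) (t n : ℕ) → 3 ≤ n → Odd n → IsTC t n H →
                (k ℓ : Fin p) →
                (∀ v i → ((i ≡ k ⊎ i ≡ ℓ) → lookup (f v) i ≡ t) × (i ≢ k → i ≢ ℓ → lookup (f v) i ≡ 0)) →
                ∀ X → Covering H X → Obstruction H f X
obstruction-C H f t n n≥3 odd (|V|≡n , ordinary , σ , _ , mults) k ℓ f-shape X cover
  with FP.any? (λ v → ¬? (proj₁ (cover v) FP.≟ k) ×-dec ¬? (proj₁ (cover v) FP.≟ ℓ))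
... | yes (v , ≢k , ≢ℓ) = zero-obstruction v (proj₁ (cover v)) (proj₂ (cover v)) (proj₂ (f-shape v _) ≢k ≢ℓ)
... | no ¬elsewhere
  with odd-cycle-monochromatic-step (subst Odd (sym |V|≡n) odd) (λ i → proj₁ (cover (σ i))) k ℓ (λ i → in-k-or-ℓ (σ i))
  where
  in-k-or-ℓ : ∀ v → proj₁ (cover v) ≡ k ⊎ proj₁ (cover v) ≡ ℓ
  in-k-or-ℓ v with proj₁ (cover v) FP.≟ k | proj₁ (cover v) FP.≟ ℓ
  ... | yes ≡k | _    = inj₁ ≡k
  ... | no _   | yes ≡ℓ = inj₂ ≡ℓ
  ... | no ≢k  | no ≢ℓ  = ⊥-elim (¬elsewhere (v , ≢k , ≢ℓ))
... | i , same-class = obstruction κ Y (induced H Y) (induced-sub H Y , heavy) Y⊆Xκ (a , ∈pairˡ a b)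
  where
  open Neighbours (subst (3 ≤_) (sym |V|≡n) n≥3) i
  a = σ i
  b = σ (next i)
  κ = proj₁ (cover a)
  Y = ⁅ a ⁆ ∪ ⁅ b ⁆
  Y⊆Xκ : Y ⊆ X κ
  Y⊆Xκ = pair⊆ (proj₂ (cover a)) (subst (λ c → b ∈ X c) (sym same-class) (proj₂ (cover b)))
  κ∈kℓ : κ ≡ k ⊎ κ ≡ ℓ
  κ∈kℓ with κ FP.≟ k | κ FP.≟ ℓ
  ... | yes ≡k | _      = inj₁ ≡k
  ... | no _   | yes ≡ℓ = inj₂ ≡ℓ
  ... | no ≢k  | no ≢ℓ  = ⊥-elim (¬elsewhere (a , ≢k , ≢ℓ))
  adjacent : CycSucc (nV H) i (next i)
  adjacent = proj₂ (successor i)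
  heavy : ∀ w → w ∈ Y → lookup (f w) κ ≤ degIn H (induced H Y) w
  heavy w w∈Y rewrite proj₁ (f-shape w κ) κ∈kℓ with ∈pair⇒ w∈Y
  ... | inj₁ refl = subst (_≤ _) (proj₁ (mults i (next i) (λ q → next≢i (sym q))) (inj₁ adjacent))
                      (mult≤induced-degree H ordinary Y a b (∈pairˡ a b) (∈pairʳ a b))
  ... | inj₂ refl = subst (_≤ _) (proj₁ (mults (next i) i next≢i) (inj₂ adjacent))
                      (mult≤induced-degree H ordinary Y b a (∈pairʳ a b) (∈pairˡ a b))

nothing-heavy : ∀ H {g : Vtx H → ℕ} → Heavy H g ∅ ∅
nothing-heavy H = (λ e e∈ → ⊥-elim (∉⊥ e∈)) , (λ v v∈ → ⊥-elim (∉⊥ v∈))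

pullback-disjoint : ∀ {p} (H' H : Hypergraph) (φ : Vtx H' → Vtx H) (X : Fin p → VSet H) →
                    Disjoint H X → Disjoint H' (λ i → preimage φ (X i))
pullback-disjoint H' H φ X disjoint i j i≢j a a∈ a∈' =
  disjoint i j i≢j (φ a) (preimage⇒ φ a a∈) (preimage⇒ φ a a∈')

pullback-covering : ∀ {p} (H' H : Hypergraph) (φ : Vtx H' → Vtx H) (X : Fin p → VSet H) →
                    Covering H X → Covering H' (λ i → preimage φ (X i))
pullback-covering H' H φ X cover a = proj₁ (cover (φ a)) , ∈preimage φ a (proj₂ (cover (φ a)))

heavy-at-φ₁ : ∀ {p H¹ H² H v¹ v²} (m : Merge H¹ H² H v¹ v²) {f : Vtx H → Vec ℕ p} {f¹ f²} →
              MergedLabels m f f¹ f² → ∀ i (F : ESet H) (F₁ : ESet H¹) (F₂ : ESet H²) →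
              (∀ e → lookup F (Merge.ε₁ m e) ≡ lookup F₁ e) → (∀ e → lookup F (Merge.ε₂ m e) ≡ lookup F₂ e) →
              ∀ a → lookup (f¹ a) i ≤ degIn H¹ F₁ a → (a ≡ v¹ → lookup (f² v²) i ≤ degIn H² F₂ v²) →
              lookup (f (Merge.φ₁ m a)) i ≤ degIn H F (Merge.φ₁ m a)
heavy-at-φ₁ {H¹ = H¹} {H²} {H} {v¹} {v²} m {f} {f¹} {f²} ℓ i F F₁ F₂ F≡F₁ F≡F₂ a bound¹ bound²
  with a FP.≟ v¹
... | yes refl = begin
  lookup (f (φ₁ a)) i                              ≡⟨ cong (λ z → lookup z i) glued ⟩
  lookup (zipWith _+_ (f¹ a) (f² v²)) i            ≡⟨ VP.lookup-zipWith _+_ i (f¹ a) (f² v²) ⟩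
  lookup (f¹ a) i + lookup (f² v²) i               ≤⟨ ℕP.+-mono-≤ bound¹ (bound² refl) ⟩
  degIn H¹ F₁ a + degIn H² F₂ v²                   ≡⟨ cong (degIn H¹ F₁ a +_) (sym (through₂-glued F₂)) ⟩
  degIn H¹ F₁ a + through₂ F₂ (φ₁ a)               ≡⟨ sym (degIn-split F F₁ F₂ F≡F₁ F≡F₂ a) ⟩
  degIn H F (φ₁ a)                                 ∎
  where
  open ℕP.≤-Reasoning
  open Merge m
  open MergedLabels ℓ
  open MergeDegrees m
... | no a≢v¹ = begin
  lookup (f (φ₁ a)) i                  ≡⟨ cong (λ z → lookup z i) (away₁ a a≢v¹) ⟩
  lookup (f¹ a) i                      ≤⟨ bound¹ ⟩
  degIn H¹ F₁ a                        ≤⟨ ℕP.m≤m+n _ _ ⟩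
  degIn H¹ F₁ a + through₂ F₂ (φ₁ a)   ≡⟨ sym (degIn-split F F₁ F₂ F≡F₁ F≡F₂ a) ⟩
  degIn H F (φ₁ a)                     ∎
  where
  open ℕP.≤-Reasoning
  open Merge m
  open MergedLabels ℓ
  open MergeDegrees m

module MergeObstruction {H¹ H² H : Hypergraph} {v¹ : Vtx H¹} {v² : Vtx H²} (m : Merge H¹ H² H v¹ v²) where
  open Merge m

  edgeUnion : ESet H¹ → ESet H² → ESet H
  edgeUnion F₁ F₂ = tabulate (λ e → [ lookup F₁ , lookup F₂ ]′ (origin e))

  edgeUnion-ε₁ : ∀ F₁ F₂ e → lookup (edgeUnion F₁ F₂) (ε₁ e) ≡ lookup F₁ e
  edgeUnion-ε₁ F₁ F₂ e = trans (VP.lookup∘tabulate _ (ε₁ e)) (cong [ lookup F₁ , lookup F₂ ]′ (origin₁ e))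

  edgeUnion-ε₂ : ∀ F₁ F₂ e → lookup (edgeUnion F₁ F₂) (ε₂ e) ≡ lookup F₂ e
  edgeUnion-ε₂ F₁ F₂ e = trans (VP.lookup∘tabulate _ (ε₂ e)) (cong [ lookup F₁ , lookup F₂ ]′ (origin₂ e))

  union-sub : ∀ {Y₁ F₁ Y₂ F₂} → IsSub H¹ Y₁ F₁ → IsSub H² Y₂ F₂ →
              IsSub H (image φ₁ Y₁ ∪ image φ₂ Y₂) (edgeUnion F₁ F₂)
  union-sub {Y₁} {F₁} {Y₂} {F₂} sub₁ sub₂ e e∈ {x} x∈e with edge-cover e
  ... | inj₁ (e₁ , refl) with inc₁⊆ e₁ x x∈e
  ... | a , refl = ∈∪ˡ (∈image φ₁ a (sub₁ e₁ (∈-lookup (trans (sym (edgeUnion-ε₁ F₁ F₂ e₁)) (lookup-∈ e∈)))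
                                             (inc₁⁻ e₁ a x∈e)))
  union-sub {Y₁} {F₁} {Y₂} {F₂} sub₁ sub₂ e e∈ {x} x∈e | inj₂ (e₂ , refl) with inc₂⊆ e₂ x x∈e
  ... | b , refl = ∈∪ʳ (∈image φ₂ b (sub₂ e₂ (∈-lookup (trans (sym (edgeUnion-ε₂ F₁ F₂ e₂)) (lookup-∈ e∈)))
                                             (inc₂⁻ e₂ b x∈e)))

  union-inside : ∀ {Y₁ Y₂} (Z : VSet H) → Y₁ ⊆ preimage φ₁ Z → Y₂ ⊆ preimage φ₂ Z →
                 image φ₁ Y₁ ∪ image φ₂ Y₂ ⊆ Z
  union-inside Z Y₁⊆ Y₂⊆ {x} x∈ with ∪⇒ x∈
  ... | inj₁ x∈₁ with image⇒ φ₁ x x∈₁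
  ... | a , a∈ , refl = preimage⇒ φ₁ a (Y₁⊆ a∈)
  union-inside Z Y₁⊆ Y₂⊆ {x} x∈ | inj₂ x∈₂ with image⇒ φ₂ x x∈₂
  ... | b , b∈ , refl = preimage⇒ φ₂ b (Y₂⊆ b∈)

  heavy-union : ∀ {p} {f : Vtx H → Vec ℕ p} {f¹ f²} → MergedLabels m f f¹ f² → ∀ i {Y₁ F₁ Y₂ F₂} →
                Heavy H¹ (λ a → lookup (f¹ a) i) Y₁ F₁ → Heavy H² (λ b → lookup (f² b) i) Y₂ F₂ →
                (v¹ ∈ Y₁ → v² ∈ Y₂) → (v² ∈ Y₂ → v¹ ∈ Y₁) →
                Heavy H (λ x → lookup (f x) i) (image φ₁ Y₁ ∪ image φ₂ Y₂) (edgeUnion F₁ F₂)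
  heavy-union {f = f} ℓ i {Y₁} {F₁} {Y₂} {F₂} (sub₁ , heavy₁) (sub₂ , heavy₂) v¹⇒v² v²⇒v¹ =
    union-sub sub₁ sub₂ , heavy
    where
    heavy : ∀ x → x ∈ image φ₁ Y₁ ∪ image φ₂ Y₂ → lookup (f x) i ≤ degIn H (edgeUnion F₁ F₂) x
    heavy x x∈ with ∪⇒ x∈
    ... | inj₁ x∈₁ with image⇒ φ₁ x x∈₁
    ... | a , a∈ , refl = heavy-at-φ₁ m ℓ i (edgeUnion F₁ F₂) F₁ F₂ (edgeUnion-ε₁ F₁ F₂) (edgeUnion-ε₂ F₁ F₂)
                            a (heavy₁ a a∈) (λ { refl → heavy₂ v² (v¹⇒v² a∈) })
    heavy x x∈ | inj₂ x∈₂ with image⇒ φ₂ x x∈₂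
    ... | b , b∈ , refl = heavy-at-φ₁ (swap m) (swapLabels ℓ) i (edgeUnion F₁ F₂) F₂ F₁ (edgeUnion-ε₂ F₁ F₂) (edgeUnion-ε₁ F₁ F₂)
                            b (heavy₂ b b∈) (λ { refl → heavy₁ v¹ (v²⇒v¹ b∈) })

  union-obstruction : ∀ {p} {f : Vtx H → Vec ℕ p} {f¹ f²} → MergedLabels m f f¹ f² → (X : Fin p → VSet H) →
                      ∀ i {Y₁ F₁ Y₂ F₂} → Heavy H¹ (λ a → lookup (f¹ a) i) Y₁ F₁ → Heavy H² (λ b → lookup (f² b) i) Y₂ F₂ →
                      Y₁ ⊆ preimage φ₁ (X i) → Y₂ ⊆ preimage φ₂ (X i) → (v¹ ∈ Y₁ → v² ∈ Y₂) → (v² ∈ Y₂ → v¹ ∈ Y₁) →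
                      Nonempty (image φ₁ Y₁ ∪ image φ₂ Y₂) → Obstruction H f X
  union-obstruction ℓ X i heavy₁ heavy₂ Y₁⊆ Y₂⊆ v¹⇒v² v²⇒v¹ ne =
    obstruction i _ _ (heavy-union ℓ i heavy₁ heavy₂ v¹⇒v² v²⇒v¹) (union-inside (X i) Y₁⊆ Y₂⊆) ne

  -- If one of them avoids
  -- the merged vertex it is an obstruction in H on its own; otherwise both lie
  -- in the class of the merged vertex and their union is one.
  merge-obstruction : ∀ {p} {f : Vtx H → Vec ℕ p} {f¹ f²} → MergedLabels m f f¹ f² →
                      ∀ {X : Fin p → VSet H} → Disjoint H X →
                      Obstruction H¹ f¹ (λ i → preimage φ₁ (X i)) → Obstruction H² f² (λ i → preimage φ₂ (X i)) →
                      Obstruction H f X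
  merge-obstruction ℓ {X} disjoint (obstruction i₁ Y₁ F₁ heavy₁ Y₁⊆ (a , a∈)) (obstruction i₂ Y₂ F₂ heavy₂ Y₂⊆ (b , b∈))
    with v¹ ∈? Y₁ | v² ∈? Y₂
  ... | no v¹∉ | _ =
    union-obstruction ℓ X i₁ heavy₁ (nothing-heavy H²) Y₁⊆ (λ x∈ → ⊥-elim (∉⊥ x∈)) (λ v¹∈ → ⊥-elim (v¹∉ v¹∈)) (λ v²∈ → ⊥-elim (∉⊥ v²∈))
      (φ₁ a , ∈∪ˡ (∈image φ₁ a a∈))
  ... | yes _ | no v²∉ =
    union-obstruction ℓ X i₂ (nothing-heavy H¹) heavy₂ (λ x∈ → ⊥-elim (∉⊥ x∈)) Y₂⊆ (λ v¹∈ → ⊥-elim (∉⊥ v¹∈)) (λ v²∈ → ⊥-elim (v²∉ v²∈))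
      (φ₂ b , ∈∪ʳ (∈image φ₂ b b∈))
  ... | yes v¹∈ | yes v²∈ with i₁ FP.≟ i₂
  ... | yes refl = union-obstruction ℓ X i₁ heavy₁ heavy₂ Y₁⊆ Y₂⊆ (λ _ → v²∈) (λ _ → v¹∈) (φ₁ a , ∈∪ˡ (∈image φ₁ a a∈))
  ... | no i₁≢i₂ = ⊥-elim (disjoint i₁ i₂ i₁≢i₂ (φ₁ v¹) (preimage⇒ φ₁ v¹ (Y₁⊆ v¹∈))
                                  (subst (_∈ X i₂) (sym glue) (preimage⇒ φ₂ v² (Y₂⊆ v²∈))))

obstruction-for : ∀ {p} {H : Hypergraph} {f : Vtx H → Vec ℕ p} → Hard {p} H f →
                  ∀ X → Disjoint H X → Covering H X → Obstruction H f X
obstruction-for (hard-M H f block j f-shape) X _ =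
  obstruction-M H f (proj₁ (proj₁ (proj₂ (proj₁ block)))) j f-shape X
obstruction-for (hard-K H f t n _ _ tK ns ∑ns+1≡n _ f≡tns) X _ =
  obstruction-K H f t n tK ns ∑ns+1≡n f≡tns X
obstruction-for (hard-C H f t n _ n≥5 odd tC k ℓ _ f-shape) X _ =
  obstruction-C H f t n (ℕP.≤-trans (s≤s (s≤s (s≤s z≤n))) n≥5) odd tC k ℓ f-shape X
obstruction-for (hard-merge H¹ f¹ H² f² H f v¹ v² hard¹ hard² md away₁ away₂ glued) X disjoint cover =
  merge-obstruction (labelsOf md f f¹ f² away₁ away₂ glued) disjoint
    (obstruction-for hard¹ _ (pullback-disjoint H¹ H φ₁ X disjoint) (pullback-covering H¹ H φ₁ X cover))
    (obstruction-for hard² _ (pullback-disjoint H² H φ₂ X disjoint) (pullback-covering H² H φ₂ X cover))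
  where
  m = fromMergeData md
  open Merge m
  open MergeObstruction m

not-partitionable : ∀ {p} {H : Hypergraph} {f : Vtx H → Vec ℕ p} → Hard {p} H f → ¬ Partitionable H f
not-partitionable hard (X , disjoint , cover , degenerate) =
  obstruction⇒¬degenerate (obstruction-for hard X disjoint cover) degenerate

Alike : ∀ {p} → Vec ℕ p → Vec ℕ p → Set
Alike {p} xs ys = xs ≡ ys ⊎ ∃[ j ] (∀ i → i ≢ j → lookup xs i ≡ 0 × lookup ys i ≡ 0)

Alike-sym : ∀ {p} {xs ys : Vec ℕ p} → Alike xs ys → Alike ys xs
Alike-sym (inj₁ xs≡ys)    = inj₁ (sym xs≡ys)
Alike-sym (inj₂ (j , h)) = inj₂ (j , λ i i≢j → Data.Product.swap (h i i≢j))

-- The statement of part (b), generalised from blocks to all connected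
-- subhypergraphs without separating vertex.
AlikeOnBlocks : ∀ {p} (H : Hypergraph) → (Vtx H → Vec ℕ p) → Set
AlikeOnBlocks H f = ∀ u u' → u ≢ u' → ¬ Separating H u → ¬ Separating H u' →
                    ∀ Y F → NonSepConnected H Y F → u ∈ Y → u' ∈ Y → Alike (f u) (f u')

module MergeSides {H¹ H² H : Hypergraph} {v¹ : Vtx H¹} {v² : Vtx H²} (m : Merge H¹ H² H v¹ v²) where
  open Merge m

  side₁ side₂ : VSet H
  side₁ = image φ₁ (allV H¹)
  side₂ = image φ₂ (allV H²)

  v* : Vtx H
  v* = φ₁ v¹

  ∈side₁ : ∀ a → φ₁ a ∈ side₁
  ∈side₁ a = ∈image φ₁ a ∈⊤

  ∈side₂ : ∀ b → φ₂ b ∈ side₂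
  ∈side₂ b = ∈image φ₂ b ∈⊤

  sides-meet : ∀ x → x ∈ side₁ → x ∈ side₂ → x ≡ v*
  sides-meet x x∈₁ x∈₂ with image⇒ φ₁ x x∈₁ | image⇒ φ₂ x x∈₂
  ... | a , _ , refl | b , _ , φ₂b≡φ₁a = cong φ₁ (proj₁ (meet a b (sym φ₂b≡φ₁a)))

  v*∈side₂ : v* ∈ side₂
  v*∈side₂ = subst (_∈ side₂) (sym glue) (∈side₂ v²)

  edge-on-one-side : ∀ e → inc H e ⊆ side₁ ⊎ inc H e ⊆ side₂
  edge-on-one-side e with edge-cover e
  ... | inj₁ (e₁ , refl) = inj₁ (λ {x} x∈ → let (a , φ₁a≡x) = inc₁⊆ e₁ x x∈ in subst (_∈ side₁) φ₁a≡x (∈side₁ a))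
  ... | inj₂ (e₂ , refl) = inj₂ (λ {x} x∈ → let (b , φ₂b≡x) = inc₂⊆ e₂ x x∈ in subst (_∈ side₂) φ₂b≡x (∈side₂ b))

  merged-vertex-separates : ∀ Y F → IsSub H Y F → v* ∈ Y →
                            ∀ a → φ₁ a ∈ Y → a ≢ v¹ → ∀ b → φ₂ b ∈ Y → b ≢ v² → SeparatingSub H Y F v*
  merged-vertex-separates Y F sub v*∈Y a a∈Y a≢v¹ b b∈Y b≢v² =
    Y ∩ side₁ , Y ∩ side₂ , covers , meets ,
    two⇒∣∣≥2 (∈∩ a∈Y (∈side₁ a)) (∈∩ v*∈Y (∈side₁ v¹)) (λ q → a≢v¹ (φ₁-inj a v¹ q)) ,
    two⇒∣∣≥2 (∈∩ b∈Y (∈side₂ b)) (∈∩ v*∈Y v*∈side₂) (λ q → b≢v² (φ₂-inj b v² (trans q glue))) ,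
    edges
    where
    covers : (Y ∩ side₁) ∪ (Y ∩ side₂) ≡ Y
    covers = set-ext (λ x x∈ → [ ∩⇒ˡ , ∩⇒ˡ ]′ (∪⇒ x∈))
      (λ x x∈Y → [ (λ (a , φ₁a≡x) → ∈∪ˡ (∈∩ x∈Y (subst (_∈ side₁) φ₁a≡x (∈side₁ a))))
                 , (λ (b , φ₂b≡x) → ∈∪ʳ (∈∩ x∈Y (subst (_∈ side₂) φ₂b≡x (∈side₂ b)))) ]′ (vertex-cover x))
    meets : (Y ∩ side₁) ∩ (Y ∩ side₂) ≡ ⁅ v* ⁆
    meets = set-ext (λ x x∈ → ≡⇒∈⁅⁆ (sides-meet x (∩⇒ʳ (∩⇒ˡ x∈)) (∩⇒ʳ (∩⇒ʳ x∈))))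
      (λ x x∈ → subst (_∈ (Y ∩ side₁) ∩ (Y ∩ side₂)) (sym (∈⁅⁆⇒≡ x∈)) (∈∩ (∈∩ v*∈Y (∈side₁ v¹)) (∈∩ v*∈Y v*∈side₂)))
    edges : ∀ e → e ∈ F → inc H e ⊆ Y ∩ side₁ ⊎ inc H e ⊆ Y ∩ side₂
    edges e e∈F = Data.Sum.map (λ e⊆ x∈ → ∈∩ (sub e e∈F x∈) (e⊆ x∈)) (λ e⊆ x∈ → ∈∩ (sub e e∈F x∈) (e⊆ x∈))
                               (edge-on-one-side e)

  merged-vertex-separating : ∀ a → a ≢ v¹ → ∀ b → b ≢ v² → Separating H v*
  merged-vertex-separating a a≢v¹ b b≢v² =
    merged-vertex-separates (allV H) (allE H) (λ _ _ _ → ∈⊤) ∈⊤ a ∈⊤ a≢v¹ b ∈⊤ b≢v²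

  within-one-half : ∀ Y F → NonSepConnected H Y F →
                    ∀ a → φ₁ a ∈ Y → a ≢ v¹ → ∀ b → φ₂ b ∈ Y → b ≢ v² → ⊥
  within-one-half Y F (sub , (_ , connected) , no-sep) a a∈Y a≢v¹ b b∈Y b≢v² with v* ∈? Y
  ... | yes v*∈Y = no-sep v* (merged-vertex-separates Y F sub v*∈Y a a∈Y a≢v¹ b b∈Y b≢v²)
  ... | no v*∉Y with connected (Y ∩ side₁) ∩⇒ˡ (φ₁ a , ∈∩ a∈Y (∈side₁ a)) (φ₂ b , ∈∩ b∈Y (x∉p⇒x∈∁p φ₂b∉))
    where
    φ₂b∉ : φ₂ b ∉ Y ∩ side₁
    φ₂b∉ φ₂b∈ = b≢v² (φ₂-inj b v² (trans (sides-meet (φ₂ b) (∩⇒ʳ φ₂b∈) (∈side₂ b)) glue))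
  -- an edge of F crossing from Y ∩ side₁ to Y \ side₁ would have to pass v*
  ... | e , _ , (x , x∈e , x∈Y₁) , (y , y∈e , y∈rest) with edge-on-one-side e
  ... | inj₁ e⊆₁ = x∈∁p⇒x∉p (∩⇒ʳ y∈rest) (∈∩ (∩⇒ˡ y∈rest) (e⊆₁ y∈e))
  ... | inj₂ e⊆₂ = v*∉Y (subst (_∈ Y) (sides-meet x (∩⇒ʳ x∈Y₁) (e⊆₂ x∈e)) (∩⇒ˡ x∈Y₁))

  edge-image : ∀ e (A : VSet H¹) → inc H¹ e ⊆ A → inc H (ε₁ e) ⊆ image φ₁ A
  edge-image e A e⊆A {x} x∈ with inc₁⊆ e x x∈
  ... | c , refl = ∈image φ₁ c (e⊆A (inc₁⁻ e c x∈))

  extend-separation : ∀ a (A B : VSet H¹) → A ∪ B ≡ allV H¹ → A ∩ B ≡ ⁅ a ⁆ → 2 ≤ ∣ A ∣ → 2 ≤ ∣ B ∣ →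
                      (∀ e → inc H¹ e ⊆ A ⊎ inc H¹ e ⊆ B) → v¹ ∈ A → Separating H (φ₁ a)
  extend-separation a A B A∪B A∩B ∣A∣≥2 ∣B∣≥2 edges v¹∈A =
    image φ₁ A ∪ side₂ , image φ₁ B , covers , meets ,
    ℕP.≤-trans (image-∣∣≥2 φ₁ φ₁-inj A ∣A∣≥2) (p⊆q⇒∣p∣≤∣q∣ {p = image φ₁ A} {q = image φ₁ A ∪ side₂} ∈∪ˡ) , image-∣∣≥2 φ₁ φ₁-inj B ∣B∣≥2 , edges′
    where
    in-A-or-B : ∀ c → c ∈ A ⊎ c ∈ B
    in-A-or-B c = ∪⇒ (subst (c ∈_) (sym A∪B) ∈⊤)
    A∩B⇒a : ∀ c → c ∈ A → c ∈ B → c ≡ a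
    A∩B⇒a c c∈A c∈B = ∈⁅⁆⇒≡ (subst (c ∈_) A∩B (∈∩ c∈A c∈B))
    a∈A∩B : a ∈ A ∩ B
    a∈A∩B = subst (a ∈_) (sym A∩B) (x∈⁅x⁆ a)
    covers : (image φ₁ A ∪ side₂) ∪ image φ₁ B ≡ allV H
    covers = set-ext (λ _ _ → ∈⊤) (λ x _ → from-cover x (vertex-cover x))
      where
      from-cover : ∀ x → (∃[ a ] φ₁ a ≡ x) ⊎ (∃[ b ] φ₂ b ≡ x) → x ∈ (image φ₁ A ∪ side₂) ∪ image φ₁ B
      from-cover _ (inj₁ (c , refl)) = [ (λ c∈A → ∈∪ˡ (∈∪ˡ (∈image φ₁ c c∈A))) , (λ c∈B → ∈∪ʳ (∈image φ₁ c c∈B)) ]′ (in-A-or-B c)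
      from-cover _ (inj₂ (d , refl)) = ∈∪ˡ (∈∪ʳ (∈side₂ d))
    meets : (image φ₁ A ∪ side₂) ∩ image φ₁ B ≡ ⁅ φ₁ a ⁆
    meets = set-ext only-φ₁a
      (λ x x∈ → subst (_∈ (image φ₁ A ∪ side₂) ∩ image φ₁ B) (sym (∈⁅⁆⇒≡ x∈))
                      (∈∩ (∈∪ˡ (∈image φ₁ a (∩⇒ˡ a∈A∩B))) (∈image φ₁ a (∩⇒ʳ a∈A∩B))))
      where
      only-φ₁a : ∀ x → x ∈ (image φ₁ A ∪ side₂) ∩ image φ₁ B → x ∈ ⁅ φ₁ a ⁆
      only-φ₁a x x∈ with image⇒ φ₁ x (∩⇒ʳ x∈)
      ... | c , c∈B , refl with ∪⇒ (∩⇒ˡ x∈)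
      ... | inj₁ φ₁c∈A  = ≡⇒∈⁅⁆ (cong φ₁ (A∩B⇒a c (image-injective φ₁ φ₁-inj c φ₁c∈A) c∈B))
      ... | inj₂ φ₁c∈₂  = ≡⇒∈⁅⁆ (cong φ₁ (A∩B⇒a c (subst (_∈ A) (sym (φ₁-inj c v¹ (sides-meet (φ₁ c) (∈side₁ c) φ₁c∈₂))) v¹∈A) c∈B))
    edges′ : ∀ e → e ∈ allE H → inc H e ⊆ image φ₁ A ∪ side₂ ⊎ inc H e ⊆ image φ₁ B
    edges′ e _ with edge-cover e
    ... | inj₂ (e₂ , refl) = inj₁ (λ {x} x∈ → let (b , φ₂b≡x) = inc₂⊆ e₂ x x∈ in ∈∪ʳ (subst (_∈ side₂) φ₂b≡x (∈side₂ b)))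
    ... | inj₁ (e₁ , refl) with edges e₁
    ... | inj₁ e⊆A = inj₁ (λ x∈ → ∈∪ˡ (edge-image e₁ A e⊆A x∈))
    ... | inj₂ e⊆B = inj₂ (edge-image e₁ B e⊆B)

  separating-lifts : ∀ a → Separating H¹ a → Separating H (φ₁ a)
  separating-lifts a (A , B , A∪B , A∩B , ∣A∣≥2 , ∣B∣≥2 , edges) with ∪⇒ (subst (v¹ ∈_) (sym A∪B) ∈⊤)
  ... | inj₁ v¹∈A = extend-separation a A B A∪B A∩B ∣A∣≥2 ∣B∣≥2 (λ e → edges e ∈⊤) v¹∈A
  ... | inj₂ v¹∈B = extend-separation a B A (trans (∪-comm B A) A∪B) (trans (∩-comm B A) A∩B) ∣B∣≥2 ∣A∣≥2
                      (λ e → Data.Sum.swap (edges e ∈⊤)) v¹∈B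

  -- A connected subhypergraph (Y, F) of H without separating vertex and with
  -- Y inside the first side is the image of one of H¹: its preimage.
  module Restriction (Y : VSet H) (F : ESet H) (nsc : NonSepConnected H Y F)
                     (Y⊆side₁ : ∀ y → y ∈ Y → ∃[ a ] φ₁ a ≡ y) where
    private
      sub = proj₁ nsc
      nonempty = proj₁ (proj₁ (proj₂ nsc))
      connected = proj₂ (proj₁ (proj₂ nsc))
      no-sep = proj₂ (proj₂ nsc)

    Y¹ : VSet H¹
    Y¹ = preimage φ₁ Y

    F¹ : ESet H¹
    F¹ = preimage ε₁ F

    -- an edge of the second half inside Y would have all its ends at v*
    F-from-first-half : ∀ e → e ∈ F → ∃[ e₁ ] ε₁ e₁ ≡ e
    F-from-first-half e e∈F with edge-cover e
    ... | inj₁ found = found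
    ... | inj₂ (e₂ , refl) = ⊥-elim (¬edge-at-one-vertex H (ε₂ e₂) v* at-v*)
      where
      at-v* : ∀ z → z ∈ inc H (ε₂ e₂) → z ≡ v*
      at-v* z z∈ with Y⊆side₁ z (sub _ e∈F z∈) | inc₂⊆ e₂ z z∈
      ... | a , φ₁a≡z | b , φ₂b≡z =
        sides-meet z (subst (_∈ side₁) φ₁a≡z (∈side₁ a)) (subst (_∈ side₂) φ₂b≡z (∈side₂ b))

    sub¹ : IsSub H¹ Y¹ F¹
    sub¹ e e∈ {a} a∈ = ∈preimage φ₁ a (sub (ε₁ e) (preimage⇒ ε₁ e e∈) (inc₁⁺ e a a∈))

    nonempty¹ : Nonempty Y¹
    nonempty¹ with nonempty
    ... | y , y∈Y with Y⊆side₁ y y∈Y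
    ... | a , refl = a , ∈preimage φ₁ a y∈Y

    -- a split of Y¹ maps to a split of Y, and the F-edge crossing it comes from H¹
    connected¹ : ∀ (Z : VSet H¹) → Z ⊆ Y¹ → Nonempty Z → Nonempty (Y¹ ∩ ∁ Z) →
                 ∃[ e ] (e ∈ F¹ × Meets H¹ e Z × Meets H¹ e (Y¹ ∩ ∁ Z))
    connected¹ Z Z⊆Y¹ (z , z∈Z) (c , c∈rest)
      with connected (image φ₁ Z) φ₁Z⊆Y (φ₁ z , ∈image φ₁ z z∈Z) (φ₁ c , ∈∩ (preimage⇒ φ₁ c (∩⇒ˡ c∈rest)) φ₁c∉φ₁Z)
      where
      φ₁Z⊆Y : image φ₁ Z ⊆ Y
      φ₁Z⊆Y {x} x∈ with image⇒ φ₁ x x∈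
      ... | a , a∈Z , refl = preimage⇒ φ₁ a (Z⊆Y¹ a∈Z)
      φ₁c∉φ₁Z : φ₁ c ∈ ∁ (image φ₁ Z)
      φ₁c∉φ₁Z = x∉p⇒x∈∁p (λ φ₁c∈ → x∈∁p⇒x∉p (∩⇒ʳ c∈rest) (image-injective φ₁ φ₁-inj c φ₁c∈))
    ... | e , e∈F , (x , x∈e , x∈φ₁Z) , (y , y∈e , y∈rest) with F-from-first-half e e∈F
    ... | e₁ , refl with image⇒ φ₁ x x∈φ₁Z | inc₁⊆ e₁ y y∈e
    ... | a , a∈Z , refl | d , refl =
      e₁ , ∈preimage ε₁ e₁ e∈F , (a , inc₁⁻ e₁ a x∈e , a∈Z) ,
      (d , inc₁⁻ e₁ d y∈e ,
       ∈∩ (∈preimage φ₁ d (∩⇒ˡ y∈rest)) (x∉p⇒x∈∁p (λ d∈Z → x∈∁p⇒x∉p (∩⇒ʳ y∈rest) (∈image φ₁ d d∈Z))))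

    -- a separation of (Y¹, F¹) at a maps to a separation of (Y, F) at φ₁ a
    no-sep¹ : ∀ a → ¬ SeparatingSub H¹ Y¹ F¹ a
    no-sep¹ a (A , B , A∪B , A∩B , ∣A∣≥2 , ∣B∣≥2 , edges) =
      no-sep (φ₁ a) (image φ₁ A , image φ₁ B , covers , meets ,
                     image-∣∣≥2 φ₁ φ₁-inj A ∣A∣≥2 , image-∣∣≥2 φ₁ φ₁-inj B ∣B∣≥2 , edges′)
      where
      a∈A∩B : a ∈ A ∩ B
      a∈A∩B = subst (a ∈_) (sym A∩B) (x∈⁅x⁆ a)
      covers : image φ₁ A ∪ image φ₁ B ≡ Y
      covers = set-ext into-Y onto-Y
        where
        into-Y : ∀ x → x ∈ image φ₁ A ∪ image φ₁ B → x ∈ Y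
        into-Y x x∈ with ∪⇒ x∈
        ... | inj₁ x∈A with image⇒ φ₁ x x∈A
        ... | c , c∈A , refl = preimage⇒ φ₁ c (subst (c ∈_) A∪B (∈∪ˡ c∈A))
        into-Y x x∈ | inj₂ x∈B with image⇒ φ₁ x x∈B
        ... | c , c∈B , refl = preimage⇒ φ₁ c (subst (c ∈_) A∪B (∈∪ʳ c∈B))
        onto-Y : ∀ x → x ∈ Y → x ∈ image φ₁ A ∪ image φ₁ B
        onto-Y x x∈Y with Y⊆side₁ x x∈Y
        ... | c , refl = Data.Sum.[ (λ c∈A → ∈∪ˡ (∈image φ₁ c c∈A)) , (λ c∈B → ∈∪ʳ (∈image φ₁ c c∈B)) ]′
                           (∪⇒ (subst (c ∈_) (sym A∪B) (∈preimage φ₁ c x∈Y)))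
      meets : image φ₁ A ∩ image φ₁ B ≡ ⁅ φ₁ a ⁆
      meets = set-ext only-φ₁a
        (λ x x∈ → subst (_∈ image φ₁ A ∩ image φ₁ B) (sym (∈⁅⁆⇒≡ x∈))
                        (∈∩ (∈image φ₁ a (∩⇒ˡ a∈A∩B)) (∈image φ₁ a (∩⇒ʳ a∈A∩B))))
        where
        only-φ₁a : ∀ x → x ∈ image φ₁ A ∩ image φ₁ B → x ∈ ⁅ φ₁ a ⁆
        only-φ₁a x x∈ with image⇒ φ₁ x (∩⇒ʳ x∈)
        ... | c , c∈B , refl = ≡⇒∈⁅⁆ (cong φ₁ (∈⁅⁆⇒≡ (subst (c ∈_) A∩B
                                  (∈∩ (image-injective φ₁ φ₁-inj c (∩⇒ˡ x∈)) c∈B))))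
      edges′ : ∀ e → e ∈ F → inc H e ⊆ image φ₁ A ⊎ inc H e ⊆ image φ₁ B
      edges′ e e∈F with F-from-first-half e e∈F
      ... | e₁ , refl with edges e₁ (∈preimage ε₁ e₁ e∈F)
      ... | inj₁ e⊆A = inj₁ (edge-image e₁ A e⊆A)
      ... | inj₂ e⊆B = inj₂ (edge-image e₁ B e⊆B)

    restricted : NonSepConnected H¹ Y¹ F¹
    restricted = sub¹ , (nonempty¹ , connected¹) , no-sep¹

module FirstHalf {p} {H¹ H² H : Hypergraph} {v¹ : Vtx H¹} {v² : Vtx H²} (m : Merge H¹ H² H v¹ v²)
                 {f : Vtx H → Vec ℕ p} {f¹ : Vtx H¹ → Vec ℕ p} {f² : Vtx H² → Vec ℕ p}
                 (ℓ : MergedLabels m f f¹ f²) (hard² : Hard {p} H² f²) (alike¹ : AlikeOnBlocks H¹ f¹) where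
  open Merge m
  open MergedLabels ℓ
  open MergeSides m

  -- f agrees with f¹ at non-separating vertices of the first half, provided
  -- H¹ has a vertex besides v¹: if φ₁ v¹ is non-separating, H² is the single
  -- vertex v², so f²(v²) = 0 by part (a).
  label-on-half : ∀ c → ¬ Separating H (φ₁ c) → (c ≡ v¹ → ∃[ c' ] c' ≢ v¹) → f (φ₁ c) ≡ f¹ c
  label-on-half c ¬sep other with c FP.≟ v¹
  ... | no c≢v¹ = away₁ c c≢v¹
  ... | yes refl with FP.any? (λ b → ¬? (b FP.≟ v²))
  ... | yes (b , b≢v²) = ⊥-elim (¬sep (merged-vertex-separating (proj₁ (other refl)) (proj₂ (other refl)) b b≢v²))
  ... | no ¬other = trans glued (zipWith-+-zero (f¹ v¹) (f² v²) (sum≡0⇒lookup≡0 (f² v²) f²v²-sum≡0))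
    where
    only-v² : ∀ b → b ≡ v²
    only-v² b = decidable-stable (b FP.≟ v²) (λ b≢v² → ¬other (b , b≢v²))
    f²v²-sum≡0 : sum (f² v²) ≡ 0
    f²v²-sum≡0 = trans (degree-sum hard² v²) (deg-one-vertex H² v² only-v²)

  -- a block through two vertices of the first half lies inside the first
  -- side, so it comes from a block of H¹, where part (b) applies
  alike-in-half : ∀ a a' → a ≢ a' → ¬ Separating H (φ₁ a) → ¬ Separating H (φ₁ a') →
                  ∀ Y F → NonSepConnected H Y F → φ₁ a ∈ Y → φ₁ a' ∈ Y → Alike (f (φ₁ a)) (f (φ₁ a'))
  alike-in-half a a' a≢a' ¬sep ¬sep' Y F nsc a∈Y a'∈Y =
    subst₂ Alike (sym (label-on-half a ¬sep (λ a≡v¹ → a' , λ a'≡v¹ → a≢a' (trans a≡v¹ (sym a'≡v¹)))))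
                 (sym (label-on-half a' ¬sep' (λ a'≡v¹ → a , λ a≡v¹ → a≢a' (trans a≡v¹ (sym a'≡v¹)))))
      (alike¹ a a' a≢a' (λ s → ¬sep (separating-lifts a s)) (λ s → ¬sep' (separating-lifts a' s))
              Y¹ F¹ restricted (∈preimage φ₁ a a∈Y) (∈preimage φ₁ a' a'∈Y))
    where
    away-in-Y : ∃[ c ] (φ₁ c ∈ Y × c ≢ v¹)
    away-in-Y with a FP.≟ v¹
    ... | no a≢v¹  = a , a∈Y , a≢v¹
    ... | yes refl = a' , a'∈Y , (λ a'≡v¹ → a≢a' (sym a'≡v¹))
    Y⊆side₁ : ∀ y → y ∈ Y → ∃[ c ] φ₁ c ≡ y
    Y⊆side₁ y y∈Y with vertex-cover y
    ... | inj₁ found = found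
    ... | inj₂ (b , refl) with b FP.≟ v²
    ... | yes refl = v¹ , glue
    ... | no b≢v² = ⊥-elim (within-one-half Y F nsc (proj₁ away-in-Y) (proj₁ (proj₂ away-in-Y)) (proj₂ (proj₂ away-in-Y)) b y∈Y b≢v²)
    open Restriction Y F nsc Y⊆side₁

-- Part (b) for a merge: two vertices in one half are handled by `FirstHalf`
-- (for the second half via `swap`); a block containing vertices from both
-- halves must pass through the merged vertex, reducing to the first case.
merge-alike : ∀ {p H¹ H² H v¹ v²} (m : Merge H¹ H² H v¹ v²) {f : Vtx H → Vec ℕ p} {f¹ f²} →
              MergedLabels m f f¹ f² → Hard {p} H¹ f¹ → Hard {p} H² f² →
              AlikeOnBlocks H¹ f¹ → AlikeOnBlocks H² f² → AlikeOnBlocks H f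
merge-alike {H = H} {v¹} {v²} m {f} ℓ hard¹ hard² alike¹ alike² = alike
  where
  open Merge m
  module Half₁ = FirstHalf m ℓ hard² alike¹
  module Half₂ = FirstHalf (swap m) (swapLabels ℓ) hard¹ alike²

  alike-across : ∀ a b → φ₁ a ≢ φ₂ b → ¬ Separating H (φ₁ a) → ¬ Separating H (φ₂ b) →
                 ∀ Y F → NonSepConnected H Y F → φ₁ a ∈ Y → φ₂ b ∈ Y → Alike (f (φ₁ a)) (f (φ₂ b))
  alike-across a b a≢b ¬sep ¬sep' Y F nsc a∈Y b∈Y with a FP.≟ v¹ | b FP.≟ v²
  ... | yes refl | _ = subst (λ z → Alike (f z) (f (φ₂ b))) (sym glue)
        (Half₂.alike-in-half v² b (λ v²≡b → a≢b (trans glue (cong φ₂ v²≡b))) (λ s → ¬sep (subst (Separating H) (sym glue) s))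
                             ¬sep' Y F nsc (subst (_∈ Y) glue a∈Y) b∈Y)
  ... | no _ | yes refl = subst (λ z → Alike (f (φ₁ a)) (f z)) glue
        (Half₁.alike-in-half a v¹ (λ a≡v¹ → a≢b (trans (cong φ₁ a≡v¹) glue)) ¬sep (λ s → ¬sep' (subst (Separating H) glue s))
                             Y F nsc a∈Y (subst (_∈ Y) (sym glue) b∈Y))
  ... | no a≢v¹ | no b≢v² = ⊥-elim (MergeSides.within-one-half m Y F nsc a a∈Y a≢v¹ b b∈Y b≢v²)

  alike : AlikeOnBlocks H f
  alike u u' u≢u' ¬sep ¬sep' Y F nsc u∈Y u'∈Y with vertex-cover u | vertex-cover u'
  ... | inj₁ (a , refl) | inj₁ (a' , refl) = Half₁.alike-in-half a a' (λ q → u≢u' (cong φ₁ q)) ¬sep ¬sep' Y F nsc u∈Y u'∈Y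
  ... | inj₂ (b , refl) | inj₂ (b' , refl) = Half₂.alike-in-half b b' (λ q → u≢u' (cong φ₂ q)) ¬sep ¬sep' Y F nsc u∈Y u'∈Y
  ... | inj₁ (a , refl) | inj₂ (b , refl) = alike-across a b u≢u' ¬sep ¬sep' Y F nsc u∈Y u'∈Y
  ... | inj₂ (b , refl) | inj₁ (a , refl) = Alike-sym (alike-across a b (λ q → u≢u' (sym q)) ¬sep' ¬sep Y F nsc u'∈Y u∈Y)

alike-on-blocks : ∀ {p} {H : Hypergraph} {f : Vtx H → Vec ℕ p} → Hard {p} H f → AlikeOnBlocks H f
alike-on-blocks (hard-M H f _ j f-shape) u u' _ _ _ _ _ _ _ _ =
  inj₂ (j , λ i i≢j → proj₂ (f-shape u i) i≢j , proj₂ (f-shape u' i) i≢j)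
alike-on-blocks (hard-K H f t n _ _ _ ns _ _ f≡tns) u u' _ _ _ _ _ _ _ _ =
  inj₁ (trans (f≡tns u) (sym (f≡tns u')))
alike-on-blocks (hard-C H f t n _ _ _ _ k ℓ _ f-shape) u u' _ _ _ _ _ _ _ _ = inj₁ (lookup-ext same)
  where
  same : ∀ i → lookup (f u) i ≡ lookup (f u') i
  same i with i FP.≟ k | i FP.≟ ℓ
  ... | yes i≡k | _      = trans (proj₁ (f-shape u i) (inj₁ i≡k)) (sym (proj₁ (f-shape u' i) (inj₁ i≡k)))
  ... | no _    | yes i≡ℓ = trans (proj₁ (f-shape u i) (inj₂ i≡ℓ)) (sym (proj₁ (f-shape u' i) (inj₂ i≡ℓ)))
  ... | no i≢k  | no i≢ℓ  = trans (proj₂ (f-shape u i) i≢k i≢ℓ) (sym (proj₂ (f-shape u' i) i≢k i≢ℓ))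
alike-on-blocks (hard-merge H¹ f¹ H² f² H f v¹ v² hard¹ hard² md away₁ away₂ glued) =
  merge-alike (fromMergeData md) (labelsOf md f f¹ f² away₁ away₂ glued) hard¹ hard²
              (alike-on-blocks hard¹) (alike-on-blocks hard²)

proposition2p2 : ∀ {p : ℕ} → 1 ≤ p → (H : Hypergraph) → (f : Vtx H → Vec ℕ p) →
    Connected H → Hard {p} H f →
    (∀ v → sum (f v) ≡ deg H v)
    × (∀ u u' → u ≢ u' → ¬ Separating H u → ¬ Separating H u' → SameBlock H u u' →
         f u ≡ f u' ⊎ ∃[ j ] (∀ i → i ≢ j → lookup (f u) i ≡ 0 × lookup (f u') i ≡ 0))
    × ¬ Partitionable H f
proposition2p2 _ H f _ hard =
  degree-sum hard ,
  (λ u u' u≢u' ¬sep ¬sep' (Y , F , block , u∈Y , u'∈Y) →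
     alike-on-blocks hard u u' u≢u' ¬sep ¬sep' Y F (proj₁ block) u∈Y u'∈Y) ,
  not-partitionable hard
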